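{- Let $d\ge2$ be an integer. The following hold. (1) For $n\in\mathbb{N}$: $\sum_{k=0}^{n}\binom nk(-1)^{n-k}H_d(k)=0$ if $n\not\equiv0\pmod d$, and $=\frac{(md)!}{m!\,d^m}$ if $n=md$. (2) For $n\in\mathbb{N}_+$ and $d\ge3$ odd: $\sum_{k=0}^{n}\binom nk(-1)^kH_d(k)H_d(n-k)=0$. (3) For $n\in\mathbb{N}_+$ and $d$ even: $\sum_{k=0}^{n}\binom nk(-1)^kH_d(k)H_d(n-k)=0$ if $n\not\equiv0\pmod d$, and $=\frac{(md)!}{m!\,(d/2)^m}$ if $n=md$. (4) If $\zeta_d$ is a $d$-th root of unity, then $H_d(n)=\zeta_d^{ -n}\sum_{k=0}^{n}\binom nk(\zeta_d-1)^kH_d(n-k)$ for $n\in\mathbb{N}$. (5) If $\zeta_{2d}$ is a $2d$-th root of unity with $\zeta_{2d}^d=-1$, then $\sum_{k=0}^{n}\binom nk\zeta_{2d}^kH_d(k)H_d(n-k)=(1+\zeta_{2d})^n$ for $n\in\mathbb{N}$. (6) If $d$ is even, then for $n\in\mathbb{N}$: $\sum_{k=0}^{\lfloor n/2\rfloor}\binom{n}{2k}\frac{2^{n-2k}}{2k+1}B_{n-2k}H_d(2k+1)=(-1)^nH_d(n)$. (7) For $n\in\mathbb{N}$: $H_d(n)=1+\sum_{i=1}^{n}(i-1)_{(d-1)}H_d(i-d)$.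
   Context: $\mathbb{N}$ denotes the non-negative integers and $\mathbb{N}_+$ the positive integers. For an integer $d\geq2$ and $n\in\mathbb{N}$, $H_d(n)$ is the number of permutations in $S_n$ that are products of pairwise disjoint $d$-cycles (identity included); $H_d(n)=1$ for $0\le n\le d-1$, $H_d(n)=H_d(n-1)+(n-1)_{(d-1)}H_d(n-d)$ for $n\ge d$, and by convention $H_d(n)=0$ for $n<0$. Here $(u)_{(m)}=u(u-1)\cdots(u-m+1)$. $(B_n)_{n\in\mathbb{N}}$ are the Bernoulli numbers, defined by $\frac{x}{e^x-1}=\sum_{n\ge0}B_n\frac{x^n}{n!}$. -}

module Defs where

open import Level using (0ℓ)
open import Data.Nat as ℕ using (ℕ; zero; suc)
open import Data.Nat.Combinatorics using (_C_)
open import Data.List using (List; []; _∷_)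
open import Data.Integer as ℤ using (ℤ; +_)
open import Data.Rational as ℚ using (ℚ)
open import Algebra.Bundles using (CommutativeRing; Semiring)
import Algebra.Definitions.RawSemiring as RS

sumLt : {A : Set} → (A → A → A) → A → ℕ → (ℕ → A) → A
sumLt _+'_ z zero    f = z
sumLt _+'_ z (suc n) f = sumLt _+'_ z n f +' f n

sumTo : {A : Set} → (A → A → A) → A → ℕ → (ℕ → A) → A
sumTo _+'_ z n f = sumLt _+'_ z (suc n) f

sumℤ : ℕ → (ℕ → ℤ) → ℤ
sumℤ = sumTo ℤ._+_ (+ 0)

sumℚ : ℕ → (ℕ → ℚ) → ℚ
sumℚ = sumTo ℚ._+_ ℚ.0ℚ

ff : ℕ → ℕ → ℕ
ff u zero    = 1
ff u (suc m) = u ℕ.* ff (u ℕ.∸ 1) m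
-- note: for u < m the product contains the factor 0, and ff u m = 0,
-- consistent with the definition (0 ∸ 1 = 0 only occurs after a 0 factor).

-- H_d(n), via the recursion
--   H_d(n) = 1 (0 ≤ n ≤ d-1),  H_d(n) = H_d(n-1) + (n-1)_(d-1) H_d(n-d) (n ≥ d).
-- Hs d n is the list [H_d(n), H_d(n-1), ..., H_d(0)].

at : List ℕ → ℕ → ℕ
at []       _       = 0
at (x ∷ xs) zero    = x
at (x ∷ xs) (suc i) = at xs i

Hs : ℕ → ℕ → List ℕ
Hs d zero    = 1 ∷ []
Hs d (suc n) = (at l 0 ℕ.+ ff n (d ℕ.∸ 1) ℕ.* at l (d ℕ.∸ 1)) ∷ l
  where l = Hs d n
-- For suc n < d (d ≥ 2) the second summand vanishes since ff n (d-1) = 0,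
-- giving H_d(suc n) = H_d(n) = 1; for suc n ≥ d, index d-1 of l is H_d(suc n - d).

H : ℕ → ℕ → ℕ
H d n = at (Hs d n) 0

Hℤ : ℕ → ℤ → ℕ
Hℤ d (+ n)      = H d n
Hℤ d ℤ.-[1+ n ] = 0

-- The rational number a / b (for b ≠ 0; junk value 0 for b = 0).

frac : ℕ → ℕ → ℚ
frac a zero    = ℚ.0ℚ
frac a (suc b) = (+ a) ℚ./ suc b

ℤ→ℚ : ℤ → ℚ
ℤ→ℚ z = z ℚ./ 1

-- Bernoulli numbers: B is the coefficient sequence of x/(e^x - 1), i.e.
--   (Σ_n B_n x^n / n!) · (e^x - 1) = x   as formal power series.
-- The coefficient of x^n/n! on the left is Σ_{k=0}^{n-1} C(n,k) B_k
-- (the constant term of e^x - 1 vanishes), and on the right it is [n = 1].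

δ₁ : ℕ → ℚ
δ₁ (suc zero) = ℚ.1ℚ
δ₁ _          = ℚ.0ℚ

IsBernoulli : (ℕ → ℚ) → Set
IsBernoulli B = ∀ n → sumLt ℚ._+_ ℚ.0ℚ n (λ k → ((+ (n C k)) ℚ./ 1) ℚ.* B k) ≡ δ₁ n
  where open import Relation.Binary.PropositionalEquality using (_≡_)

module RingOps (R : CommutativeRing 0ℓ 0ℓ) where
  open CommutativeRing R public
  open RS (Semiring.rawSemiring semiring) public using () renaming (_^_ to _^ᴿ_; _×_ to _·ᴿ_)

  sumᴿ : ℕ → (ℕ → Carrier) → Carrier
  sumᴿ = sumTo _+_ 0#

  ι : ℕ → Carrier
  ι n = n ·ᴿ 1#

module Submission where

-- The exponential generating function of H_d is H(x) = exp(x + x^d/d): its coefficient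
-- sequence is the solution of y' = y + x^(d-1) y with y(0) = 1.  Every binomial sum in the
-- theorem is a coefficient of a product of exponential generating functions, and by the
-- product rule such products again solve equations y' = α y + β x^(d-1) y, whose solutions
-- are determined by y(0).  Thus e^(-x) H(x) and, for even d, H(-x) H(x) solve y' = c x^(d-1) y,
-- so they vanish off the multiples of d and take factorial values there; for ζ^d = -1,
-- H(ζx) H(x) solves y' = (1 + ζ) y and equals e^((1+ζ)x) (ζ = -1 gives the odd case);
-- for ζ^d = 1, e^((ζ-1)x) H(x) solves the equation of H(ζx).  For (6), with
-- O(x) = (H(x) - H(-x))/(2x), both O(x) · 2x/(e^(2x) - 1) and H(-x) turn into H(x) - H(-x)
-- when multiplied by e^(2x) - 1 (for even d, H(-x) e^(2x) = H(x)), and e^(2x) - 1 cancels.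

open import Defs
open import Level using (0ℓ)
open import Data.Nat as ℕ using (ℕ; zero; suc; _∸_; _≤_; _<_; z≤n; s≤s; _!; _^_)
import Data.Nat.Properties as ℕP
import Data.Nat.DivMod as ℕDM
open import Data.Nat.Combinatorics using (_C_; nCk+nC[k+1]≡[n+1]C[k+1]; k>n⇒nCk≡0; nCk≡nC[n∸k]; nC1≡n)
open import Data.Nat.Divisibility using (_∣_; divides; ∣-refl; ∣m∣n⇒∣m+n)
open import Data.Integer as ℤ using (ℤ; +_; -[1+_]; _⊖_)
import Data.Integer.Properties as ℤP
open import Data.Rational as ℚ using (ℚ)
import Data.Rational.Properties as ℚP
open import Data.Rational.Unnormalised as ℚᵘ using (mkℚᵘ; *≡*)
import Data.Rational.Unnormalised.Properties as ℚᵘP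
open import Data.Product using (_×_; _,_; proj₁; proj₂)
open import Data.Sum using (_⊎_; inj₁; inj₂)
open import Data.Maybe using (Maybe; just; nothing)
open import Data.Empty using (⊥-elim)
open import Relation.Nullary using (¬_; yes; no)
open import Relation.Binary.PropositionalEquality as ≡ using (_≡_)
open import Algebra.Bundles using (CommutativeRing)
import Algebra.Solver.Ring as RingSolver
import Data.Nat.Solver as ℕSolver
import Data.Integer.Solver as ℤSolver
import Algebra.Solver.Ring.AlmostCommutativeRing as ACR

Hs-at : ∀ d n i → i ≤ n → at (Hs d n) i ≡ H d (n ∸ i)
Hs-at d n zero _ = ≡.refl
Hs-at d (suc n) (suc i) (s≤s i≤n) = Hs-at d n i i≤n

ff-< : ∀ {n m} → n < m → ff n m ≡ 0
ff-< {zero} {suc m} _ = ≡.refl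
ff-< {suc n} {suc m} (s≤s n<m) = ≡.trans (≡.cong (suc n ℕ.*_) (ff-< n<m)) (ℕP.*-zeroʳ (suc n))

ff-*-! : ∀ k a → ff (k ℕ.+ a) k ℕ.* a ! ≡ (k ℕ.+ a) !
ff-*-! zero a = ℕP.*-identityˡ (a !)
ff-*-! (suc k) a = ≡.trans (ℕP.*-assoc (suc (k ℕ.+ a)) (ff (k ℕ.+ a) k) (a !))
                           (≡.cong (suc (k ℕ.+ a) ℕ.*_) (ff-*-! k a))

-- Holds for every n: for n < m the truncated index n ∸ m is harmless since ff n m = 0.
H-suc : ∀ m n → H (suc m) (suc n) ≡ H (suc m) n ℕ.+ ff n m ℕ.* H (suc m) (n ∸ m)
H-suc m n with m ℕP.≤? n
... | yes m≤n = ≡.cong (λ z → H (suc m) n ℕ.+ ff n m ℕ.* z) (Hs-at (suc m) n m m≤n)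
... | no m≰n rewrite ff-< (ℕP.≰⇒> m≰n) = ≡.refl

H-unfold : ∀ m n →
  H (suc m) n ≡ 1 ℕ.+ sumLt ℕ._+_ 0 n (λ j → ff j m ℕ.* Hℤ (suc m) (+ (suc j) ℤ.- + suc m))
H-unfold m zero = ≡.refl
H-unfold m (suc n) = begin
  H (suc m) (suc n)                                      ≡⟨ H-suc m n ⟩
  H (suc m) n ℕ.+ ff n m ℕ.* H (suc m) (n ∸ m)           ≡⟨ ≡.cong₂ ℕ._+_ (H-unfold m n) last-term ⟩
  (1 ℕ.+ Σ n) ℕ.+ term n                                 ≡⟨ ℕP.+-assoc 1 (Σ n) (term n) ⟩
  1 ℕ.+ Σ (suc n)                                        ∎
  where
  open ≡.≡-Reasoning
  term : ℕ → ℕ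
  term j = ff j m ℕ.* Hℤ (suc m) (+ (suc j) ℤ.- + suc m)
  Σ : ℕ → ℕ
  Σ k = sumLt ℕ._+_ 0 k term
  last-term : ff n m ℕ.* H (suc m) (n ∸ m) ≡ term n
  last-term with m ℕP.≤? n
  ... | yes m≤n = ≡.cong (λ z → ff n m ℕ.* Hℤ (suc m) z) (≡.sym (begin
        + suc n ℤ.- + suc m    ≡⟨ ℤP.m-n≡m⊖n (suc n) (suc m) ⟩
        suc n ⊖ suc m          ≡⟨ ℤP.[1+m]⊖[1+n]≡m⊖n n m ⟩
        n ⊖ m                  ≡⟨ ℤP.⊖-≥ m≤n ⟩
        + (n ∸ m)              ∎))
  ... | no m≰n rewrite ff-< (ℕP.≰⇒> m≰n) = ≡.refl

n≡2[n/2]⊎n≡1+2[n/2] : ∀ n → n ≡ 2 ℕ.* (n ℕ./ 2) ⊎ n ≡ suc (2 ℕ.* (n ℕ./ 2))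
n≡2[n/2]⊎n≡1+2[n/2] n with n ℕ.% 2 | ℕDM.m%n<n n 2 | ℕDM.m≡m%n+[m/n]*n n 2
... | zero        | _            | eq = inj₁ (≡.trans eq (ℕP.*-comm (n ℕ./ 2) 2))
... | suc zero    | _            | eq = inj₂ (≡.trans eq (≡.cong suc (ℕP.*-comm (n ℕ./ 2) 2)))
... | suc (suc _) | s≤s (s≤s ()) | _

¬2∣⇒≡1+2[n/2] : ∀ {n} → ¬ (2 ∣ n) → n ≡ suc (n ℕ./ 2 ℕ.* 2)
¬2∣⇒≡1+2[n/2] {n} 2∤n with n≡2[n/2]⊎n≡1+2[n/2] n
... | inj₁ eq = ⊥-elim (2∤n (divides (n ℕ./ 2) (≡.trans eq (ℕP.*-comm 2 (n ℕ./ 2)))))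
... | inj₂ eq = ≡.trans eq (≡.cong suc (ℕP.*-comm 2 (n ℕ./ 2)))

module IntegerEmbedding (R : CommutativeRing 0ℓ 0ℓ) where
  open RingOps R
  open import Relation.Binary.Reasoning.Setoid setoid
  open import Algebra.Properties.Semiring.Mult semiring using (×-homo-+; ×1-homo-*)
  open import Algebra.Properties.Monoid.Mult.TCOptimised +-monoid using (×ᵤ≈×)
  open import Algebra.Definitions.RawMonoid +-rawMonoid using (_×′_)
  open import Algebra.Properties.Ring ring using (-‿involutive; -0#≈0#; -‿+-comm; -‿distribˡ-*; -‿distribʳ-*)

  ι-+ : ∀ m n → ι (m ℕ.+ n) ≈ ι m + ι n
  ι-+ = ×-homo-+ 1#

  ι-* : ∀ m n → ι (m ℕ.* n) ≈ ι m * ι n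
  ι-* = ×1-homo-*

  fromℤ : ℤ → Carrier
  fromℤ (+ n)      = ι n
  fromℤ -[1+ n ]   = - ι (suc n)

  fromℤ-neg : ∀ i → fromℤ (ℤ.- i) ≈ - fromℤ i
  fromℤ-neg (+ zero)   = sym -0#≈0#
  fromℤ-neg (+ suc n)  = refl
  fromℤ-neg -[1+ n ]   = sym (-‿involutive _)

  1+x-[1+y]≈x-y : ∀ x y → (1# + x) - (1# + y) ≈ x - y
  1+x-[1+y]≈x-y x y = begin
    (1# + x) - (1# + y)        ≈⟨ +-congˡ (sym (-‿+-comm 1# y)) ⟩
    (1# + x) + (- 1# - y)      ≈⟨ +-assoc 1# x _ ⟩
    1# + (x + (- 1# - y))      ≈⟨ +-congˡ (sym (+-assoc x (- 1#) (- y))) ⟩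
    1# + ((x - 1#) - y)        ≈⟨ +-congˡ (+-congʳ (+-comm x (- 1#))) ⟩
    1# + ((- 1# + x) - y)      ≈⟨ +-congˡ (+-assoc (- 1#) x (- y)) ⟩
    1# + (- 1# + (x - y))      ≈⟨ sym (+-assoc 1# (- 1#) _) ⟩
    (1# - 1#) + (x - y)        ≈⟨ +-congʳ (-‿inverseʳ 1#) ⟩
    0# + (x - y)               ≈⟨ +-identityˡ _ ⟩
    x - y                      ∎

  fromℤ-⊖ : ∀ m n → fromℤ (m ⊖ n) ≈ ι m - ι n
  fromℤ-⊖ m zero = begin
    fromℤ (m ⊖ 0)            ≈⟨ reflexive (≡.cong fromℤ (ℤP.⊖-≥ {m} z≤n)) ⟩
    ι m                      ≈⟨ sym (+-identityʳ _) ⟩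
    ι m + 0#                 ≈⟨ +-congˡ (sym -0#≈0#) ⟩
    ι m - 0#                 ∎
  fromℤ-⊖ zero (suc n) = begin
    fromℤ (0 ⊖ suc n)        ≈⟨ reflexive (≡.cong fromℤ (ℤP.⊖-< {0} {suc n} (s≤s z≤n))) ⟩
    - ι (suc n)              ≈⟨ sym (+-identityˡ _) ⟩
    0# - ι (suc n)           ∎
  fromℤ-⊖ (suc m) (suc n) = begin
    fromℤ (suc m ⊖ suc n)    ≈⟨ reflexive (≡.cong fromℤ (ℤP.[1+m]⊖[1+n]≡m⊖n m n)) ⟩
    fromℤ (m ⊖ n)            ≈⟨ fromℤ-⊖ m n ⟩
    ι m - ι n                ≈⟨ sym (1+x-[1+y]≈x-y (ι m) (ι n)) ⟩
    ι (suc m) - ι (suc n)    ∎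

  fromℤ-+ : ∀ i j → fromℤ (i ℤ.+ j) ≈ fromℤ i + fromℤ j
  fromℤ-+ -[1+ m ] -[1+ n ] = begin
    - ι (suc (suc (m ℕ.+ n)))    ≈⟨ -‿cong (reflexive (≡.cong ι (≡.sym (ℕP.+-suc (suc m) n)))) ⟩
    - ι (suc m ℕ.+ suc n)        ≈⟨ -‿cong (ι-+ (suc m) (suc n)) ⟩
    - (ι (suc m) + ι (suc n))    ≈⟨ sym (-‿+-comm _ _) ⟩
    - ι (suc m) - ι (suc n)      ∎
  fromℤ-+ -[1+ m ] (+ n) = trans (fromℤ-⊖ n (suc m)) (+-comm _ _)
  fromℤ-+ (+ m) -[1+ n ] = fromℤ-⊖ m (suc n)
  fromℤ-+ (+ m) (+ n)    = ι-+ m n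

  fromℤ-+* : ∀ m j → fromℤ (+ m ℤ.* j) ≈ ι m * fromℤ j
  fromℤ-+* m (+ n) = trans (reflexive (≡.cong fromℤ (≡.sym (ℤP.pos-* m n)))) (ι-* m n)
  fromℤ-+* m -[1+ n ] = begin
    fromℤ (+ m ℤ.* -[1+ n ])        ≈⟨ reflexive (≡.cong fromℤ (≡.sym (ℤP.neg-distribʳ-* (+ m) (+ suc n)))) ⟩
    fromℤ (ℤ.- (+ m ℤ.* + suc n))   ≈⟨ fromℤ-neg (+ m ℤ.* + suc n) ⟩
    - fromℤ (+ m ℤ.* + suc n)       ≈⟨ -‿cong (fromℤ-+* m (+ suc n)) ⟩
    - (ι m * ι (suc n))             ≈⟨ -‿distribʳ-* (ι m) _ ⟩
    ι m * - ι (suc n)               ∎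

  fromℤ-* : ∀ i j → fromℤ (i ℤ.* j) ≈ fromℤ i * fromℤ j
  fromℤ-* (+ m) j = fromℤ-+* m j
  fromℤ-* -[1+ m ] j = begin
    fromℤ (-[1+ m ] ℤ.* j)           ≈⟨ reflexive (≡.cong fromℤ (≡.sym (ℤP.neg-distribˡ-* (+ suc m) j))) ⟩
    fromℤ (ℤ.- (+ suc m ℤ.* j))      ≈⟨ fromℤ-neg (+ suc m ℤ.* j) ⟩
    - fromℤ (+ suc m ℤ.* j)          ≈⟨ -‿cong (fromℤ-+* (suc m) j) ⟩
    - (ι (suc m) * fromℤ j)        ≈⟨ -‿distribˡ-* (ι (suc m)) _ ⟩
    - ι (suc m) * fromℤ j          ∎

  ι′ : ℕ → Carrier
  ι′ n = n ×′ 1#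

  ι′≈ι : ∀ n → ι′ n ≈ ι n
  ι′≈ι n = sym (×ᵤ≈× n 1#)

  -- The solver needs constants whose image is syntactically 1# at 1, which ι (= 1# + 0#) is not.
  ⟦_⟧ : ℤ → Carrier
  ⟦ + n ⟧      = ι′ n
  ⟦ -[1+ n ] ⟧ = - ι′ (suc n)

  ⟦⟧≈fromℤ : ∀ i → ⟦ i ⟧ ≈ fromℤ i
  ⟦⟧≈fromℤ (+ n)      = ι′≈ι n
  ⟦⟧≈fromℤ -[1+ n ]   = -‿cong (ι′≈ι (suc n))

  ⟦⟧-homomorphism : ℤ.+-*-rawRing ACR.-Raw-AlmostCommutative⟶ ACR.fromCommutativeRing R
  ⟦⟧-homomorphism = record
    { ⟦_⟧    = ⟦_⟧
    ; +-homo = λ i j → via (i ℤ.+ j) (fromℤ-+ i j) (+-cong (⟦⟧≈fromℤ i) (⟦⟧≈fromℤ j))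
    ; *-homo = λ i j → via (i ℤ.* j) (fromℤ-* i j) (*-cong (⟦⟧≈fromℤ i) (⟦⟧≈fromℤ j))
    ; -‿homo = λ i → via (ℤ.- i) (fromℤ-neg i) (-‿cong (⟦⟧≈fromℤ i))
    ; 0-homo = refl
    ; 1-homo = refl
    }
    where
    via : ∀ i {x y} → fromℤ i ≈ y → x ≈ y → ⟦ i ⟧ ≈ x
    via i eq x≈y = trans (⟦⟧≈fromℤ i) (trans eq (sym x≈y))

  ⟦⟧-equal? : ∀ i j → Maybe (⟦ i ⟧ ≈ ⟦ j ⟧)
  ⟦⟧-equal? i j with i ℤ.≟ j
  ... | yes ≡.refl = just refl
  ... | no _       = nothing

  open RingSolver ℤ.+-*-rawRing (ACR.fromCommutativeRing R) ⟦⟧-homomorphism ⟦⟧-equal? public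
    using (solve; _:=_; _:+_; _:*_; :-_; _:-_; con)

module ExponentialSeries (R : CommutativeRing 0ℓ 0ℓ) where
  open RingOps R hiding (zero)
  open IntegerEmbedding R public
  open import Relation.Binary.Reasoning.Setoid setoid
  open import Algebra.Properties.Semiring.Mult semiring using (×-homo-+; ×-assocˡ; ×-congʳ; ×-comm-*; ×-assoc-*)
  open import Algebra.Properties.CommutativeMonoid.Mult +-commutativeMonoid using (×-distrib-+)
  import Algebra.Properties.CommutativeSemigroup +-commutativeSemigroup as +-Semigroup

  ×≈ι* : ∀ k x → k ·ᴿ x ≈ ι k * x
  ×≈ι* k x = trans (×-congʳ k (sym (*-identityˡ x))) (sym (×-assoc-* k 1# x))

  ×-zeroʳ : ∀ k → k ·ᴿ 0# ≈ 0#
  ×-zeroʳ zero    = refl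
  ×-zeroʳ (suc k) = trans (+-identityˡ _) (×-zeroʳ k)

  Σ : ℕ → (ℕ → Carrier) → Carrier
  Σ = sumLt _+_ 0#

  Σ-cong< : ∀ n {f g} → (∀ k → k < n → f k ≈ g k) → Σ n f ≈ Σ n g
  Σ-cong< zero    f≈g = refl
  Σ-cong< (suc n) f≈g = +-cong (Σ-cong< n (λ k k<n → f≈g k (ℕP.m<n⇒m<1+n k<n))) (f≈g n (ℕP.n<1+n n))

  Σ-cong : ∀ n {f g} → (∀ k → f k ≈ g k) → Σ n f ≈ Σ n g
  Σ-cong n f≈g = Σ-cong< n (λ k _ → f≈g k)

  Σ-zero : ∀ n f → (∀ k → k < n → f k ≈ 0#) → Σ n f ≈ 0#
  Σ-zero zero    f f≈0 = refl
  Σ-zero (suc n) f f≈0 =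
    trans (+-cong (Σ-zero n f (λ k k<n → f≈0 k (ℕP.m<n⇒m<1+n k<n))) (f≈0 n (ℕP.n<1+n n))) (+-identityʳ 0#)

  Σ-+ : ∀ n f g → Σ n (λ k → f k + g k) ≈ Σ n f + Σ n g
  Σ-+ zero    f g = sym (+-identityʳ 0#)
  Σ-+ (suc n) f g = trans (+-congʳ (Σ-+ n f g)) (+-Semigroup.interchange _ _ _ _)

  *-Σ : ∀ n c f → c * Σ n f ≈ Σ n (λ k → c * f k)
  *-Σ zero    c f = zeroʳ c
  *-Σ (suc n) c f = trans (distribˡ c _ _) (+-congʳ (*-Σ n c f))

  Σ-suc : ∀ n f → Σ (suc n) f ≈ f 0 + Σ n (λ j → f (suc j))
  Σ-suc zero    f = trans (+-identityˡ (f 0)) (sym (+-identityʳ (f 0)))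
  Σ-suc (suc n) f = trans (+-congʳ (Σ-suc n f)) (+-assoc _ _ _)

  private
    Σ-evens-of : ∀ q G → (∀ k → G (suc (2 ℕ.* k)) ≈ 0#) →
                 (Σ (suc (2 ℕ.* q)) G ≈ Σ (suc q) (λ k → G (2 ℕ.* k)))
                 × (Σ (suc (suc (2 ℕ.* q))) G ≈ Σ (suc q) (λ k → G (2 ℕ.* k)))
    Σ-evens-of zero    G odd≈0 = refl , trans (+-congˡ (odd≈0 0)) (+-identityʳ _)
    Σ-evens-of (suc q) G odd≈0 = even-end , trans (+-congˡ (odd≈0 (suc q))) (trans (+-identityʳ _) even-end)
      where
      2[1+q]≡2+2q : 2 ℕ.* suc q ≡ suc (suc (2 ℕ.* q))
      2[1+q]≡2+2q = ℕP.*-suc 2 q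
      even-end : Σ (suc (2 ℕ.* suc q)) G ≈ Σ (suc (suc q)) (λ k → G (2 ℕ.* k))
      even-end = trans (reflexive (≡.cong (λ z → Σ (suc z) G) 2[1+q]≡2+2q))
                       (+-cong (proj₂ (Σ-evens-of q G odd≈0)) (reflexive (≡.cong G (≡.sym 2[1+q]≡2+2q))))

  Σ-evens : ∀ n G → (∀ k → G (suc (2 ℕ.* k)) ≈ 0#) → Σ (suc n) G ≈ Σ (suc (n ℕ./ 2)) (λ k → G (2 ℕ.* k))
  Σ-evens n G odd≈0 with n≡2[n/2]⊎n≡1+2[n/2] n
  ... | inj₁ eq = trans (reflexive (≡.cong (λ z → Σ (suc z) G) eq)) (proj₁ (Σ-evens-of (n ℕ./ 2) G odd≈0))
  ... | inj₂ eq = trans (reflexive (≡.cong (λ z → Σ (suc z) G) eq)) (proj₂ (Σ-evens-of (n ℕ./ 2) G odd≈0))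

  -1^[2+n]≈-1^n : ∀ n → (- 1#) ^ᴿ suc (suc n) ≈ (- 1#) ^ᴿ n
  -1^[2+n]≈-1^n n = solve 1 (λ x → :- con (+ 1) :* (:- con (+ 1) :* x) := x) refl _

  -1^[q*2]≈1 : ∀ q → (- 1#) ^ᴿ (q ℕ.* 2) ≈ 1#
  -1^[q*2]≈1 zero    = refl
  -1^[q*2]≈1 (suc q) = trans (-1^[2+n]≈-1^n (q ℕ.* 2)) (-1^[q*2]≈1 q)

  -1^even≈1 : ∀ {n} → 2 ∣ n → (- 1#) ^ᴿ n ≈ 1#
  -1^even≈1 (divides q ≡.refl) = -1^[q*2]≈1 q

  -1^odd≈-1 : ∀ {n} → ¬ (2 ∣ n) → (- 1#) ^ᴿ n ≈ - 1#
  -1^odd≈-1 {n} 2∤n = begin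
    (- 1#) ^ᴿ n                       ≡⟨ ≡.cong ((- 1#) ^ᴿ_) (¬2∣⇒≡1+2[n/2] 2∤n) ⟩
    - 1# * (- 1#) ^ᴿ (n ℕ./ 2 ℕ.* 2)  ≈⟨ *-congˡ (-1^[q*2]≈1 (n ℕ./ 2)) ⟩
    - 1# * 1#                         ≈⟨ *-identityʳ _ ⟩
    - 1#                              ∎

  Seq : Set
  Seq = ℕ → Carrier

  infix 4 _≋_
  _≋_ : Seq → Seq → Set
  a ≋ b = ∀ n → a n ≈ b n

  -- Sequences are coefficient sequences of exponential generating functions: shift is the
  -- derivative, _⊛_ the product and mulX the multiplication by x.
  shift : Seq → Seq
  shift a n = a (suc n)

  infixl 7 _⊛_
  _⊛_ : Seq → Seq → Seq
  (a ⊛ b) n = sumᴿ n (λ k → (n C k) ·ᴿ (a k * b (n ∸ k)))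

  ⊛-cong : ∀ {a a′ b b′} → a ≋ a′ → b ≋ b′ → a ⊛ b ≋ a′ ⊛ b′
  ⊛-cong a≋a′ b≋b′ n = Σ-cong (suc n) (λ k → ×-congʳ (n C k) (*-cong (a≋a′ k) (b≋b′ (n ∸ k))))

  ⊛-congˡ : ∀ {a a′} b → a ≋ a′ → a ⊛ b ≋ a′ ⊛ b
  ⊛-congˡ b a≋a′ = ⊛-cong {b = b} {b′ = b} a≋a′ (λ _ → refl)

  ⊛-congʳ : ∀ a {b b′} → b ≋ b′ → a ⊛ b ≋ a ⊛ b′
  ⊛-congʳ a b≋b′ = ⊛-cong {a = a} {a′ = a} (λ _ → refl) b≋b′

  ⊛-zero-index : ∀ a b → (a ⊛ b) 0 ≈ a 0 * b 0
  ⊛-zero-index a b = trans (+-identityˡ _) (+-identityʳ _)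

  ⊛-shift : ∀ a b n → (a ⊛ b) (suc n) ≈ (shift a ⊛ b) n + (a ⊛ shift b) n
  ⊛-shift a b n = begin
    (a ⊛ b) (suc n)                                     ≈⟨ Σ-suc (suc n) T ⟩
    T 0 + Σ (suc n) (λ j → T (suc j))                   ≈⟨ +-congˡ (Σ-cong (suc n) pascal) ⟩
    T 0 + Σ (suc n) (λ j → W j + U j)                   ≈⟨ +-congˡ (Σ-+ (suc n) W U) ⟩
    T 0 + ((shift a ⊛ b) n + (Σ n U + U n))             ≈⟨ +-congˡ (+-congˡ (+-congˡ Un≈0)) ⟩
    T 0 + ((shift a ⊛ b) n + (Σ n U + 0#))              ≈⟨ +-congˡ (+-congˡ (+-identityʳ _)) ⟩
    T 0 + ((shift a ⊛ b) n + Σ n U)                     ≈⟨ +-Semigroup.x∙yz≈y∙xz _ _ _ ⟩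
    (shift a ⊛ b) n + (T 0 + Σ n U)                     ≈⟨ +-congˡ (+-congˡ (Σ-cong< n U≈V∘suc)) ⟩
    (shift a ⊛ b) n + (V 0 + Σ n (λ j → V (suc j)))     ≈⟨ +-congˡ (sym (Σ-suc n V)) ⟩
    (shift a ⊛ b) n + (a ⊛ shift b) n                   ∎
    where
    T W U V : ℕ → Carrier
    T k = (suc n C k) ·ᴿ (a k * b (suc n ∸ k))
    W j = (n C j) ·ᴿ (a (suc j) * b (n ∸ j))
    U j = (n C suc j) ·ᴿ (a (suc j) * b (n ∸ j))
    V k = (n C k) ·ᴿ (a k * b (suc (n ∸ k)))
    pascal : ∀ j → T (suc j) ≈ W j + U j
    pascal j = trans (reflexive (≡.cong (_·ᴿ (a (suc j) * b (n ∸ j))) (≡.sym (nCk+nC[k+1]≡[n+1]C[k+1] n j))))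
                     (×-homo-+ _ (n C j) (n C suc j))
    Un≈0 : U n ≈ 0#
    Un≈0 = reflexive (≡.cong (_·ᴿ (a (suc n) * b (n ∸ n))) (k>n⇒nCk≡0 (ℕP.n<1+n n)))
    U≈V∘suc : ∀ j → j < n → U j ≈ V (suc j)
    U≈V∘suc j j<n = reflexive (≡.cong (λ i → (n C suc j) ·ᴿ (a (suc j) * b i)) (ℕP.+-∸-assoc 1 j<n))

  ⊛-distribʳ-+ : ∀ a a′ b → (λ k → a k + a′ k) ⊛ b ≋ λ n → (a ⊛ b) n + (a′ ⊛ b) n
  ⊛-distribʳ-+ a a′ b n = trans (Σ-cong (suc n) term) (Σ-+ (suc n) _ _)
    where
    term : ∀ k → (n C k) ·ᴿ ((a k + a′ k) * b (n ∸ k))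
                 ≈ (n C k) ·ᴿ (a k * b (n ∸ k)) + (n C k) ·ᴿ (a′ k * b (n ∸ k))
    term k = trans (×-congʳ (n C k) (distribʳ _ _ _)) (×-distrib-+ _ _ (n C k))

  ⊛-distribˡ-+ : ∀ a b b′ → a ⊛ (λ k → b k + b′ k) ≋ λ n → (a ⊛ b) n + (a ⊛ b′) n
  ⊛-distribˡ-+ a b b′ n = trans (Σ-cong (suc n) term) (Σ-+ (suc n) _ _)
    where
    term : ∀ k → (n C k) ·ᴿ (a k * (b (n ∸ k) + b′ (n ∸ k)))
                 ≈ (n C k) ·ᴿ (a k * b (n ∸ k)) + (n C k) ·ᴿ (a k * b′ (n ∸ k))
    term k = trans (×-congʳ (n C k) (distribˡ _ _ _)) (×-distrib-+ _ _ (n C k))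

  ⊛-*ˡ : ∀ c a b → (λ k → c * a k) ⊛ b ≋ λ n → c * (a ⊛ b) n
  ⊛-*ˡ c a b n = trans (Σ-cong (suc n) term) (sym (*-Σ (suc n) c _))
    where
    term : ∀ k → (n C k) ·ᴿ ((c * a k) * b (n ∸ k)) ≈ c * ((n C k) ·ᴿ (a k * b (n ∸ k)))
    term k = trans (×-congʳ (n C k) (*-assoc _ _ _)) (sym (×-comm-* (n C k) c _))

  ⊛-*ʳ : ∀ c a b → a ⊛ (λ k → c * b k) ≋ λ n → c * (a ⊛ b) n
  ⊛-*ʳ c a b n = trans (Σ-cong (suc n) term) (sym (*-Σ (suc n) c _))
    where
    term : ∀ k → (n C k) ·ᴿ (a k * (c * b (n ∸ k))) ≈ c * ((n C k) ·ᴿ (a k * b (n ∸ k)))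
    term k = trans (×-congʳ (n C k) (trans (sym (*-assoc _ _ _)) (trans (*-congʳ (*-comm _ _)) (*-assoc _ _ _))))
                   (sym (×-comm-* (n C k) c _))

  ⊛-zeroʳ : ∀ a → a ⊛ (λ _ → 0#) ≋ λ _ → 0#
  ⊛-zeroʳ a n = Σ-zero (suc n) _ (λ k _ → trans (×-congʳ (n C k) (zeroʳ _)) (×-zeroʳ (n C k)))

  ⊛-comm : ∀ a b → a ⊛ b ≋ b ⊛ a
  ⊛-comm a b zero = trans (⊛-zero-index a b) (trans (*-comm _ _) (sym (⊛-zero-index b a)))
  ⊛-comm a b (suc n) = begin
    (a ⊛ b) (suc n)                            ≈⟨ ⊛-shift a b n ⟩
    (shift a ⊛ b) n + (a ⊛ shift b) n          ≈⟨ +-cong (⊛-comm (shift a) b n) (⊛-comm a (shift b) n) ⟩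
    (b ⊛ shift a) n + (shift b ⊛ a) n          ≈⟨ +-comm _ _ ⟩
    (shift b ⊛ a) n + (b ⊛ shift a) n          ≈⟨ sym (⊛-shift b a n) ⟩
    (b ⊛ a) (suc n)                            ∎

  ⊛-assoc : ∀ a b c → (a ⊛ b) ⊛ c ≋ a ⊛ (b ⊛ c)
  ⊛-assoc a b c zero = begin
    ((a ⊛ b) ⊛ c) 0        ≈⟨ trans (⊛-zero-index (a ⊛ b) c) (*-congʳ (⊛-zero-index a b)) ⟩
    (a 0 * b 0) * c 0      ≈⟨ *-assoc _ _ _ ⟩
    a 0 * (b 0 * c 0)      ≈⟨ sym (trans (⊛-zero-index a (b ⊛ c)) (*-congˡ (⊛-zero-index b c))) ⟩
    (a ⊛ (b ⊛ c)) 0        ∎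
  ⊛-assoc a b c (suc n) = begin
    ((a ⊛ b) ⊛ c) (suc n)
      ≈⟨ ⊛-shift (a ⊛ b) c n ⟩
    (shift (a ⊛ b) ⊛ c) n + ((a ⊛ b) ⊛ shift c) n
      ≈⟨ +-congʳ (trans (⊛-congˡ c (⊛-shift a b) n) (⊛-distribʳ-+ (shift a ⊛ b) (a ⊛ shift b) c n)) ⟩
    (((shift a ⊛ b) ⊛ c) n + ((a ⊛ shift b) ⊛ c) n) + ((a ⊛ b) ⊛ shift c) n
      ≈⟨ +-cong (+-cong (⊛-assoc (shift a) b c n) (⊛-assoc a (shift b) c n)) (⊛-assoc a b (shift c) n) ⟩
    ((shift a ⊛ (b ⊛ c)) n + (a ⊛ (shift b ⊛ c)) n) + (a ⊛ (b ⊛ shift c)) n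
      ≈⟨ +-assoc _ _ _ ⟩
    (shift a ⊛ (b ⊛ c)) n + ((a ⊛ (shift b ⊛ c)) n + (a ⊛ (b ⊛ shift c)) n)
      ≈⟨ +-congˡ (sym (trans (⊛-congʳ a (⊛-shift b c) n) (⊛-distribˡ-+ a (shift b ⊛ c) (b ⊛ shift c) n))) ⟩
    (shift a ⊛ (b ⊛ c)) n + (a ⊛ shift (b ⊛ c)) n
      ≈⟨ sym (⊛-shift a (b ⊛ c) n) ⟩
    (a ⊛ (b ⊛ c)) (suc n) ∎

  δ₀ : Seq
  δ₀ zero    = 1#
  δ₀ (suc _) = 0#

  ⊛-identityʳ : ∀ a → a ⊛ δ₀ ≋ a
  ⊛-identityʳ a zero    = trans (⊛-zero-index a δ₀) (*-identityʳ _)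
  ⊛-identityʳ a (suc n) = trans (⊛-shift a δ₀ n) (trans (+-cong (⊛-identityʳ (shift a) n) (⊛-zeroʳ a n)) (+-identityʳ _))

  mulX : Seq → Seq
  mulX a zero    = 0#
  mulX a (suc n) = suc n ·ᴿ a n

  shift-mulX : ∀ a → shift (mulX a) ≋ λ n → a n + mulX (shift a) n
  shift-mulX a zero    = refl
  shift-mulX a (suc n) = refl

  mulX-cong : ∀ {a b} → a ≋ b → mulX a ≋ mulX b
  mulX-cong a≋b zero    = refl
  mulX-cong a≋b (suc n) = ×-congʳ (suc n) (a≋b n)

  mulX-+ : ∀ a b → mulX (λ k → a k + b k) ≋ λ n → mulX a n + mulX b n
  mulX-+ a b zero    = sym (+-identityʳ 0#)
  mulX-+ a b (suc n) = ×-distrib-+ (a n) (b n) (suc n)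

  ⊛-mulXˡ : ∀ a b → mulX a ⊛ b ≋ mulX (a ⊛ b)
  ⊛-mulXˡ a b zero    = trans (⊛-zero-index (mulX a) b) (zeroˡ _)
  ⊛-mulXˡ a b (suc n) = begin
    (mulX a ⊛ b) (suc n)
      ≈⟨ ⊛-shift (mulX a) b n ⟩
    (shift (mulX a) ⊛ b) n + (mulX a ⊛ shift b) n
      ≈⟨ +-congʳ (trans (⊛-congˡ b (shift-mulX a) n) (⊛-distribʳ-+ a (mulX (shift a)) b n)) ⟩
    ((a ⊛ b) n + (mulX (shift a) ⊛ b) n) + (mulX a ⊛ shift b) n
      ≈⟨ +-cong (+-congˡ (⊛-mulXˡ (shift a) b n)) (⊛-mulXˡ a (shift b) n) ⟩
    ((a ⊛ b) n + mulX (shift a ⊛ b) n) + mulX (a ⊛ shift b) n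
      ≈⟨ +-assoc _ _ _ ⟩
    (a ⊛ b) n + (mulX (shift a ⊛ b) n + mulX (a ⊛ shift b) n)
      ≈⟨ +-congˡ (sym (trans (mulX-cong (⊛-shift a b) n) (mulX-+ (shift a ⊛ b) (a ⊛ shift b) n))) ⟩
    (a ⊛ b) n + mulX (shift (a ⊛ b)) n
      ≈⟨ sym (shift-mulX (a ⊛ b) n) ⟩
    mulX (a ⊛ b) (suc n) ∎

  ⊛-mulXʳ : ∀ a b → a ⊛ mulX b ≋ mulX (a ⊛ b)
  ⊛-mulXʳ a b n = trans (⊛-comm a (mulX b) n) (trans (⊛-mulXˡ b a n) (mulX-cong (⊛-comm b a) n))

  mulXⁿ : ℕ → Seq → Seq
  mulXⁿ zero    a = a
  mulXⁿ (suc m) a = mulX (mulXⁿ m a)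

  ⊛-mulXⁿˡ : ∀ m a b → mulXⁿ m a ⊛ b ≋ mulXⁿ m (a ⊛ b)
  ⊛-mulXⁿˡ zero    a b n = refl
  ⊛-mulXⁿˡ (suc m) a b n = trans (⊛-mulXˡ (mulXⁿ m a) b n) (mulX-cong (⊛-mulXⁿˡ m a b) n)

  ⊛-mulXⁿʳ : ∀ m a b → a ⊛ mulXⁿ m b ≋ mulXⁿ m (a ⊛ b)
  ⊛-mulXⁿʳ zero    a b n = refl
  ⊛-mulXⁿʳ (suc m) a b n = trans (⊛-mulXʳ a (mulXⁿ m b) n) (mulX-cong (⊛-mulXⁿʳ m a b) n)

  mulXⁿ≈ff· : ∀ m a n → mulXⁿ m a n ≈ ff n m ·ᴿ a (n ∸ m)
  mulXⁿ≈ff· zero    a n       = sym (+-identityʳ _)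
  mulXⁿ≈ff· (suc m) a zero    = refl
  mulXⁿ≈ff· (suc m) a (suc n) = trans (×-congʳ (suc n) (mulXⁿ≈ff· m a n)) (×-assocˡ _ (suc n) (ff n m))

  mulXⁿ-local : ∀ m n a b → (∀ k → k ≤ n → a k ≈ b k) → mulXⁿ m a n ≈ mulXⁿ m b n
  mulXⁿ-local zero    n       a b a≈b = a≈b n ℕP.≤-refl
  mulXⁿ-local (suc m) zero    a b a≈b = refl
  mulXⁿ-local (suc m) (suc n) a b a≈b = ×-congʳ (suc n) (mulXⁿ-local m n a b (λ k k≤n → a≈b k (ℕP.m≤n⇒m≤1+n k≤n)))

  record Solves (α β : Carrier) (m : ℕ) (y : Seq) : Set where
    constructor solves
    field
      recurrence : ∀ n → y (suc n) ≈ α * y n + β * mulXⁿ m y n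
  open Solves public

  Solves-unique : ∀ {α β m u v} → Solves α β m u → Solves α β m v → u 0 ≈ v 0 → u ≋ v
  Solves-unique {α} {β} {m} {u} {v} u′ v′ u0≈v0 n = agree n n ℕP.≤-refl
    where
    agree : ∀ n k → k ≤ n → u k ≈ v k
    agree zero .zero z≤n = u0≈v0
    agree (suc n) k k≤1+n with ℕP.m≤n⇒m<n∨m≡n k≤1+n
    ... | inj₁ k<1+n  = agree n k (ℕP.≤-pred k<1+n)
    ... | inj₂ ≡.refl = trans (recurrence u′ n) (trans (+-cong (*-congˡ (agree n n ℕP.≤-refl))
                                                    (*-congˡ (mulXⁿ-local m n u v (agree n))))
                                             (sym (recurrence v′ n)))

  pow : Carrier → Seq
  pow a n = a ^ᴿ n

  scale : Carrier → Seq → Seq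
  scale ζ a n = (ζ ^ᴿ n) * a n

  Solves-cong : ∀ {α α′ β β′ m y} → α ≈ α′ → β ≈ β′ → Solves α β m y → Solves α′ β′ m y
  Solves-cong α≈α′ β≈β′ y′ = solves λ n → trans (recurrence y′ n) (+-cong (*-congʳ α≈α′) (*-congʳ β≈β′))

  Solves-pow : ∀ a m → Solves a 0# m (pow a)
  Solves-pow a m = solves λ n → sym (trans (+-congˡ (zeroˡ _)) (+-identityʳ _))

  Solves-⊛ : ∀ {α β α′ β′ m a b} → Solves α β m a → Solves α′ β′ m b →
             Solves (α + α′) (β + β′) m (a ⊛ b)
  Solves-⊛ {α} {β} {α′} {β′} {m} {a} {b} a′ b′ = solves step
    where
    step : ∀ n → (a ⊛ b) (suc n) ≈ (α + α′) * (a ⊛ b) n + (β + β′) * mulXⁿ m (a ⊛ b) n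
    step n = begin
      (a ⊛ b) (suc n)
        ≈⟨ ⊛-shift a b n ⟩
      (shift a ⊛ b) n + (a ⊛ shift b) n
        ≈⟨ +-cong (⊛-congˡ b (recurrence a′) n) (⊛-congʳ a (recurrence b′) n) ⟩
      ((λ k → α * a k + β * mulXⁿ m a k) ⊛ b) n + (a ⊛ (λ k → α′ * b k + β′ * mulXⁿ m b k)) n
        ≈⟨ +-cong (⊛-distribʳ-+ (λ k → α * a k) (λ k → β * mulXⁿ m a k) b n)
                  (⊛-distribˡ-+ a (λ k → α′ * b k) (λ k → β′ * mulXⁿ m b k) n) ⟩
      (((λ k → α * a k) ⊛ b) n + ((λ k → β * mulXⁿ m a k) ⊛ b) n)
        + ((a ⊛ (λ k → α′ * b k)) n + (a ⊛ (λ k → β′ * mulXⁿ m b k)) n)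
        ≈⟨ +-cong (+-cong (⊛-*ˡ α a b n) (trans (⊛-*ˡ β (mulXⁿ m a) b n) (*-congˡ (⊛-mulXⁿˡ m a b n))))
                  (+-cong (⊛-*ʳ α′ a b n) (trans (⊛-*ʳ β′ a (mulXⁿ m b) n) (*-congˡ (⊛-mulXⁿʳ m a b n)))) ⟩
      (α * Y + β * Z) + (α′ * Y + β′ * Z)
        ≈⟨ solve 6 (λ α β α′ β′ y z → (α :* y :+ β :* z) :+ (α′ :* y :+ β′ :* z) := (α :+ α′) :* y :+ (β :+ β′) :* z)
                 refl α β α′ β′ Y Z ⟩
      (α + α′) * Y + (β + β′) * Z ∎
      where
      Y = (a ⊛ b) n
      Z = mulXⁿ m (a ⊛ b) n

  ^suc-*-mulXⁿ : ∀ ζ m y n → ζ ^ᴿ suc n * mulXⁿ m y n ≈ ζ ^ᴿ suc m * mulXⁿ m (scale ζ y) n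
  ^suc-*-mulXⁿ ζ zero    y n       = solve 3 (λ ζ p y → (ζ :* p) :* y := (ζ :* con (+ 1)) :* (p :* y)) refl ζ (ζ ^ᴿ n) (y n)
  ^suc-*-mulXⁿ ζ (suc m) y zero    = trans (zeroʳ _) (sym (zeroʳ _))
  ^suc-*-mulXⁿ ζ (suc m) y (suc n) = begin
    ζ ^ᴿ suc (suc n) * (suc n ·ᴿ mulXⁿ m y n)              ≈⟨ ×-comm-* (suc n) _ _ ⟩
    suc n ·ᴿ (ζ * ζ ^ᴿ suc n * mulXⁿ m y n)                ≈⟨ ×-congʳ (suc n) (*-assoc _ _ _) ⟩
    suc n ·ᴿ (ζ * (ζ ^ᴿ suc n * mulXⁿ m y n))              ≈⟨ ×-congʳ (suc n) (*-congˡ (^suc-*-mulXⁿ ζ m y n)) ⟩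
    suc n ·ᴿ (ζ * (ζ ^ᴿ suc m * mulXⁿ m (scale ζ y) n))    ≈⟨ ×-congʳ (suc n) (sym (*-assoc _ _ _)) ⟩
    suc n ·ᴿ (ζ ^ᴿ suc (suc m) * mulXⁿ m (scale ζ y) n)    ≈⟨ sym (×-comm-* (suc n) _ _) ⟩
    ζ ^ᴿ suc (suc m) * (suc n ·ᴿ mulXⁿ m (scale ζ y) n)    ∎

  Solves-scale : ∀ {α β m y} ζ → Solves α β m y → Solves (ζ * α) (ζ ^ᴿ suc m * β) m (scale ζ y)
  Solves-scale {α} {β} {m} {y} ζ y′ = solves step
    where
    step : ∀ n → scale ζ y (suc n) ≈ ζ * α * scale ζ y n + ζ ^ᴿ suc m * β * mulXⁿ m (scale ζ y) n
    step n = begin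
      ζ * ζ ^ᴿ n * y (suc n)
        ≈⟨ *-congˡ (recurrence y′ n) ⟩
      ζ * ζ ^ᴿ n * (α * y n + β * mulXⁿ m y n)
        ≈⟨ solve 6 (λ ζ p α β y w → ζ :* p :* (α :* y :+ β :* w) := ζ :* α :* (p :* y) :+ β :* (ζ :* p :* w))
                 refl ζ (ζ ^ᴿ n) α β (y n) (mulXⁿ m y n) ⟩
      ζ * α * scale ζ y n + β * (ζ ^ᴿ suc n * mulXⁿ m y n)
        ≈⟨ +-congˡ (*-congˡ (^suc-*-mulXⁿ ζ m y n)) ⟩
      ζ * α * scale ζ y n + β * (ζ ^ᴿ suc m * Z)
        ≈⟨ +-congˡ (solve 3 (λ β p z → β :* (p :* z) := p :* β :* z) refl β (ζ ^ᴿ suc m) Z) ⟩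
      ζ * α * scale ζ y n + ζ ^ᴿ suc m * β * Z
        ∎
      where
      Z = mulXⁿ m (scale ζ y) n

  evenPart : Seq → Seq
  evenPart a zero          = a 0
  evenPart a (suc zero)    = 0#
  evenPart a (suc (suc n)) = evenPart (λ k → a (suc (suc k))) n

  evenPart-even : ∀ a k → evenPart a (2 ℕ.* k) ≈ a (2 ℕ.* k)
  evenPart-even a zero    = refl
  evenPart-even a (suc k) = begin
    evenPart a (2 ℕ.* suc k)                  ≡⟨ ≡.cong (evenPart a) (ℕP.*-suc 2 k) ⟩
    evenPart (λ j → a (suc (suc j))) (2 ℕ.* k) ≈⟨ evenPart-even (λ j → a (suc (suc j))) k ⟩
    a (suc (suc (2 ℕ.* k)))                   ≡⟨ ≡.cong a (ℕP.*-suc 2 k) ⟨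
    a (2 ℕ.* suc k)                           ∎

  evenPart-odd : ∀ a k → evenPart a (suc (2 ℕ.* k)) ≈ 0#
  evenPart-odd a zero    = refl
  evenPart-odd a (suc k) = begin
    evenPart a (suc (2 ℕ.* suc k))                   ≡⟨ ≡.cong (λ j → evenPart a (suc j)) (ℕP.*-suc 2 k) ⟩
    evenPart (λ j → a (suc (suc j))) (suc (2 ℕ.* k)) ≈⟨ evenPart-odd (λ j → a (suc (suc j))) k ⟩
    0#                                               ∎

  evenPart-twice : ∀ a n → (1# + 1#) * evenPart a n ≈ (1# + (- 1#) ^ᴿ n) * a n
  evenPart-twice a zero          = refl
  evenPart-twice a (suc zero)    =
    trans (zeroʳ _) (solve 1 (λ x → con (+ 0) := (con (+ 1) :+ :- con (+ 1) :* con (+ 1)) :* x) refl (a 1))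
  evenPart-twice a (suc (suc n)) = trans (evenPart-twice (λ k → a (suc (suc k))) n)
                                         (*-congʳ (+-congˡ (sym (-1^[2+n]≈-1^n n))))

  ⊛-leading : ∀ Z E n → E 0 ≈ 0# → (∀ k → k < n → Z k ≈ 0#) → (Z ⊛ E) (suc n) ≈ ι (suc n) * (Z n * E 1)
  ⊛-leading Z E n E0≈0 Z<n≈0 = begin
    (Z ⊛ E) (suc n)                   ≈⟨ trans (+-congˡ top) (+-identityʳ _) ⟩
    Σ n term + term n                 ≈⟨ +-cong (Σ-zero n term lower) next ⟩
    0# + ι (suc n) * (Z n * E 1)      ≈⟨ +-identityˡ _ ⟩
    ι (suc n) * (Z n * E 1)           ∎
    where
    term : ℕ → Carrier
    term k = (suc n C k) ·ᴿ (Z k * E (suc n ∸ k))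
    top : term (suc n) ≈ 0#
    top = trans (×-congʳ (suc n C suc n) (trans (*-congˡ (trans (reflexive (≡.cong E (ℕP.n∸n≡0 n))) E0≈0)) (zeroʳ _)))
                (×-zeroʳ (suc n C suc n))
    1+n-C-n≡1+n : suc n C n ≡ suc n
    1+n-C-n≡1+n = ≡.trans (nCk≡nC[n∸k] (ℕP.n≤1+n n)) (≡.trans (≡.cong (suc n C_) (ℕP.m+n∸n≡m 1 n)) (nC1≡n (suc n)))
    next : term n ≈ ι (suc n) * (Z n * E 1)
    next = trans (×≈ι* (suc n C n) _)
                 (*-cong (reflexive (≡.cong ι 1+n-C-n≡1+n)) (*-congˡ (reflexive (≡.cong E (ℕP.m+n∸n≡m 1 n)))))
    lower : ∀ k → k < n → term k ≈ 0#
    lower k k<n = trans (×-congʳ (suc n C k) (trans (*-congʳ (Z<n≈0 k k<n)) (zeroˡ _))) (×-zeroʳ (suc n C k))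

  -- Read off coefficient n + 1 of Z E = 0: all lower Z k vanish, so (n + 1) Z n E 1 = 0.
  ⊛-cancelʳ : (inv : ℕ → Carrier) → (∀ j → ι (suc j) * inv j ≈ 1#) →
              ∀ E e → E 0 ≈ 0# → E 1 * e ≈ 1# → ∀ Z → Z ⊛ E ≋ (λ _ → 0#) → Z ≋ λ _ → 0#
  ⊛-cancelʳ inv inv-ι E e E0≈0 E1e≈1 Z Z⊛E≈0 n = vanish (suc n) n (ℕP.n<1+n n)
    where
    step : ∀ n → (∀ k → k < n → Z k ≈ 0#) → Z n ≈ 0#
    step n Z<n≈0 = begin
      Z n                                          ≈⟨ sym (trans (*-congˡ (*-identityʳ 1#)) (*-identityʳ _)) ⟩
      Z n * (1# * 1#)                              ≈⟨ *-congˡ (sym (*-cong (inv-ι n) E1e≈1)) ⟩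
      Z n * ((ι (suc n) * inv n) * (E 1 * e))      ≈⟨ solve 5 (λ z i a t b → z :* ((i :* a) :* (t :* b)) := (a :* b) :* (i :* (z :* t)))
                                                              refl (Z n) (ι (suc n)) (inv n) (E 1) e ⟩
      (inv n * e) * (ι (suc n) * (Z n * E 1))      ≈⟨ *-congˡ (trans (sym (⊛-leading Z E n E0≈0 Z<n≈0)) (Z⊛E≈0 (suc n))) ⟩
      (inv n * e) * 0#                             ≈⟨ zeroʳ _ ⟩
      0#                                           ∎
    vanish : ∀ N k → k < N → Z k ≈ 0#
    vanish (suc N) k k<1+N with ℕP.m<1+n⇒m<n∨m≡n k<1+N
    ... | inj₁ k<N    = vanish N k k<N
    ... | inj₂ ≡.refl = step k (vanish k)

module HSeries (R : CommutativeRing 0ℓ 0ℓ) (m : ℕ) where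
  open RingOps R hiding (zero)
  open ExponentialSeries R
  open import Relation.Binary.Reasoning.Setoid setoid
  open import Algebra.Properties.Semiring.Mult semiring using (×-assocˡ; ×-congʳ)
  open import Algebra.Properties.CommutativeSemiring.Exp commutativeSemiring using (^-distrib-*; ^-congˡ)

  h : Seq
  h n = ι (H (suc m) n)

  h-zero : h 0 ≈ 1#
  h-zero = +-identityʳ 1#

  h-solves : Solves 1# 1# m h
  h-solves = solves step
    where
    step : ∀ n → h (suc n) ≈ 1# * h n + 1# * mulXⁿ m h n
    step n = begin
      h (suc n)                                               ≈⟨ reflexive (≡.cong ι (H-suc m n)) ⟩
      ι (H (suc m) n ℕ.+ ff n m ℕ.* H (suc m) (n ∸ m))        ≈⟨ ι-+ (H (suc m) n) _ ⟩
      h n + ι (ff n m ℕ.* H (suc m) (n ∸ m))                  ≈⟨ +-congˡ (sym (×-assocˡ 1# (ff n m) _)) ⟩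
      h n + ff n m ·ᴿ h (n ∸ m)                               ≈⟨ +-congˡ (sym (mulXⁿ≈ff· m h n)) ⟩
      h n + mulXⁿ m h n                                       ≈⟨ sym (+-cong (*-identityˡ _) (*-identityˡ _)) ⟩
      1# * h n + 1# * mulXⁿ m h n                             ∎

  h⊛pow[-1]-solves : Solves 0# 1# m (h ⊛ pow (- 1#))
  h⊛pow[-1]-solves = Solves-cong (-‿inverseʳ 1#) (+-identityʳ 1#) (Solves-⊛ h-solves (Solves-pow (- 1#) m))

  h⊛pow[-1]-zero : (h ⊛ pow (- 1#)) 0 ≈ 1#
  h⊛pow[-1]-zero = trans (⊛-zero-index h (pow (- 1#))) (trans (*-identityʳ _) h-zero)

  h[-x]⊛h-solves : Solves 0# ((- 1#) ^ᴿ suc m + 1#) m (scale (- 1#) h ⊛ h)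
  h[-x]⊛h-solves = Solves-cong (trans (+-congʳ (*-identityʳ _)) (-‿inverseˡ 1#)) (+-congʳ (*-identityʳ _))
                               (Solves-⊛ (Solves-scale (- 1#) h-solves) h-solves)

  h[ζx]⊛h-zero : ∀ ζ → (scale ζ h ⊛ h) 0 ≈ 1#
  h[ζx]⊛h-zero ζ = trans (⊛-zero-index (scale ζ h) h) (trans (*-cong (trans (*-identityˡ _) h-zero) h-zero) (*-identityˡ _))

  h[ζx]≋pow[ζ-1]⊛h : ∀ ζ → ζ ^ᴿ suc m ≈ 1# → scale ζ h ≋ pow (ζ - 1#) ⊛ h
  h[ζx]≋pow[ζ-1]⊛h ζ ζᵈ≈1 = Solves-unique scaled product (sym (⊛-zero-index (pow (ζ - 1#)) h))
    where
    scaled : Solves ζ 1# m (scale ζ h)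
    scaled = Solves-cong (*-identityʳ ζ) (trans (*-identityʳ _) ζᵈ≈1) (Solves-scale ζ h-solves)
    product : Solves ζ 1# m (pow (ζ - 1#) ⊛ h)
    product = Solves-cong (solve 1 (λ z → (z :- con (+ 1)) :+ con (+ 1) := z) refl ζ) (+-identityˡ 1#)
                          (Solves-⊛ (Solves-pow (ζ - 1#) m) h-solves)

  h[ζx]⊛h≋pow[1+ζ] : ∀ ζ → ζ ^ᴿ suc m ≈ - 1# → scale ζ h ⊛ h ≋ pow (1# + ζ)
  h[ζx]⊛h≋pow[1+ζ] ζ ζᵈ≈-1 = Solves-unique product (Solves-pow (1# + ζ) m) (h[ζx]⊛h-zero ζ)
    where
    product : Solves (1# + ζ) 0# m (scale ζ h ⊛ h)
    product = Solves-cong (trans (+-congʳ (*-identityʳ ζ)) (+-comm ζ 1#))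
                          (trans (+-congʳ (trans (*-identityʳ _) ζᵈ≈-1)) (-‿inverseˡ 1#))
                          (Solves-⊛ (Solves-scale ζ h-solves) h-solves)

  h[-x]⊛h-vanishes : (- 1#) ^ᴿ suc m ≈ - 1# → ∀ n → (scale (- 1#) h ⊛ h) (suc n) ≈ 0#
  h[-x]⊛h-vanishes -1ᵈ≈-1 n =
    trans (h[ζx]⊛h≋pow[1+ζ] (- 1#) -1ᵈ≈-1 (suc n)) (trans (*-congʳ (-‿inverseʳ 1#)) (zeroˡ _))

  private
    1^n≈1 : ∀ n → 1# ^ᴿ n ≈ 1#
    1^n≈1 zero    = refl
    1^n≈1 (suc n) = trans (*-identityˡ _) (1^n≈1 n)

  h≈ζ⁻ⁿ[pow[ζ-1]⊛h] : ∀ ζ ζ⁻¹ → ζ ^ᴿ suc m ≈ 1# → ζ * ζ⁻¹ ≈ 1# →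
                      ∀ n → h n ≈ ζ⁻¹ ^ᴿ n * (pow (ζ - 1#) ⊛ h) n
  h≈ζ⁻ⁿ[pow[ζ-1]⊛h] ζ ζ⁻¹ ζᵈ≈1 ζζ⁻¹≈1 n = begin
    h n                                 ≈⟨ sym (trans (*-congʳ (1^n≈1 n)) (*-identityˡ _)) ⟩
    1# ^ᴿ n * h n                       ≈⟨ *-congʳ (^-congˡ n (sym (trans (*-comm ζ⁻¹ ζ) ζζ⁻¹≈1))) ⟩
    (ζ⁻¹ * ζ) ^ᴿ n * h n                ≈⟨ *-congʳ (^-distrib-* ζ⁻¹ ζ n) ⟩
    ζ⁻¹ ^ᴿ n * ζ ^ᴿ n * h n             ≈⟨ *-assoc _ _ _ ⟩
    ζ⁻¹ ^ᴿ n * scale ζ h n              ≈⟨ *-congˡ (h[ζx]≋pow[ζ-1]⊛h ζ ζᵈ≈1 n) ⟩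
    ζ⁻¹ ^ᴿ n * (pow (ζ - 1#) ⊛ h) n     ∎

  module Bernoulli (inv : ℕ → Carrier) (inv-ι : ∀ j → ι (suc j) * inv j ≈ 1#)
                   (B : Seq) (B-rec : ∀ n → Σ n (λ k → ι (n C k) * B k) ≈ mulX δ₀ n)
                   (-1ᵈ≈1 : (- 1#) ^ᴿ suc m ≈ 1#) where

    two : Carrier
    two = 1# + 1#

    -- e^(2x) - 1
    E : Seq
    E zero    = 0#
    E (suc j) = two ^ᴿ suc j

    E≋pow₂-δ₀ : E ≋ λ k → pow two k + - 1# * δ₀ k
    E≋pow₂-δ₀ zero    = solve 0 (con (+ 0) := con (+ 1) :+ :- con (+ 1) :* con (+ 1)) refl
    E≋pow₂-δ₀ (suc k) = sym (trans (+-congˡ (zeroʳ _)) (+-identityʳ _))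

    -- (h(x) - h(-x)) / (2x)
    oddQuotient : Seq
    oddQuotient = evenPart (λ j → inv j * h (suc j))

    B₂ : Seq
    B₂ = scale two B

    B₂⊛E≋2x : B₂ ⊛ E ≋ mulX (λ k → two * δ₀ k)
    B₂⊛E≋2x n = begin
      (B₂ ⊛ E) n                                   ≈⟨ trans (+-congˡ top) (+-identityʳ _) ⟩
      Σ n term                                     ≈⟨ Σ-cong< n term≈ ⟩
      Σ n (λ k → two ^ᴿ n * (ι (n C k) * B k))     ≈⟨ sym (*-Σ n (two ^ᴿ n) _) ⟩
      two ^ᴿ n * Σ n (λ k → ι (n C k) * B k)       ≈⟨ *-congˡ (B-rec n) ⟩
      two ^ᴿ n * mulX δ₀ n                         ≈⟨ scaled-x n ⟩
      mulX (λ k → two * δ₀ k) n                    ∎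
      where
      open import Algebra.Properties.Semiring.Exp semiring using (^-homo-*)
      term : ℕ → Carrier
      term k = (n C k) ·ᴿ (B₂ k * E (n ∸ k))
      top : term n ≈ 0#
      top = trans (×-congʳ (n C n) (trans (*-congˡ (reflexive (≡.cong E (ℕP.n∸n≡0 n)))) (zeroʳ _))) (×-zeroʳ (n C n))
      term≈ : ∀ k → k < n → term k ≈ two ^ᴿ n * (ι (n C k) * B k)
      term≈ k k<n = begin
        (n C k) ·ᴿ ((two ^ᴿ k * B k) * E (n ∸ k))
          ≈⟨ ×≈ι* (n C k) _ ⟩
        ι (n C k) * ((two ^ᴿ k * B k) * E (n ∸ k))
          ≈⟨ *-congˡ (*-congˡ (E-pos (ℕP.m<n⇒0<n∸m k<n))) ⟩
        ι (n C k) * ((two ^ᴿ k * B k) * two ^ᴿ (n ∸ k))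
          ≈⟨ solve 4 (λ c p b q → c :* ((p :* b) :* q) := (p :* q) :* (c :* b)) refl _ _ _ _ ⟩
        (two ^ᴿ k * two ^ᴿ (n ∸ k)) * (ι (n C k) * B k)
          ≈⟨ *-congʳ (sym (^-homo-* two k (n ∸ k))) ⟩
        two ^ᴿ (k ℕ.+ (n ∸ k)) * (ι (n C k) * B k)
          ≡⟨ ≡.cong (λ j → two ^ᴿ j * (ι (n C k) * B k)) (ℕP.m+[n∸m]≡n (ℕP.<⇒≤ k<n)) ⟩
        two ^ᴿ n * (ι (n C k) * B k)
          ∎
        where
        E-pos : ∀ {j} → 0 < j → E j ≈ two ^ᴿ j
        E-pos {suc j} _ = refl
      scaled-x : ∀ n → two ^ᴿ n * mulX δ₀ n ≈ mulX (λ k → two * δ₀ k) n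
      scaled-x zero          = zeroʳ _
      scaled-x (suc zero)    = solve 1 (λ t → (t :* con (+ 1)) :* (con (+ 1) :+ con (+ 0)) := t :* con (+ 1) :+ con (+ 0)) refl two
      scaled-x (suc (suc n)) = begin
        two ^ᴿ suc (suc n) * (suc (suc n) ·ᴿ 0#)     ≈⟨ *-congˡ (×-zeroʳ (suc (suc n))) ⟩
        two ^ᴿ suc (suc n) * 0#                      ≈⟨ zeroʳ _ ⟩
        0#                                           ≈⟨ sym (×-zeroʳ (suc (suc n))) ⟩
        suc (suc n) ·ᴿ 0#                            ≈⟨ ×-congʳ (suc (suc n)) (sym (zeroʳ two)) ⟩
        suc (suc n) ·ᴿ (two * 0#)                    ∎

    [oddQuotient⊛B₂]⊛E≋2x·oddQuotient : (oddQuotient ⊛ B₂) ⊛ E ≋ mulX (λ j → two * oddQuotient j)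
    [oddQuotient⊛B₂]⊛E≋2x·oddQuotient n = begin
      ((oddQuotient ⊛ B₂) ⊛ E) n                    ≈⟨ ⊛-assoc oddQuotient B₂ E n ⟩
      (oddQuotient ⊛ (B₂ ⊛ E)) n                    ≈⟨ ⊛-congʳ oddQuotient B₂⊛E≋2x n ⟩
      (oddQuotient ⊛ mulX (λ k → two * δ₀ k)) n     ≈⟨ ⊛-mulXʳ oddQuotient _ n ⟩
      mulX (oddQuotient ⊛ (λ k → two * δ₀ k)) n     ≈⟨ mulX-cong twice n ⟩
      mulX (λ j → two * oddQuotient j) n            ∎
      where
      twice : oddQuotient ⊛ (λ k → two * δ₀ k) ≋ λ j → two * oddQuotient j
      twice k = trans (⊛-*ʳ two oddQuotient δ₀ k) (*-congˡ (⊛-identityʳ oddQuotient k))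

    2x·oddQuotient≋h-h[-x] : mulX (λ j → two * oddQuotient j) ≋ λ n → h n - scale (- 1#) h n
    2x·oddQuotient≋h-h[-x] zero    = solve 1 (λ x → con (+ 0) := x :- con (+ 1) :* x) refl (h 0)
    2x·oddQuotient≋h-h[-x] (suc j) = begin
      suc j ·ᴿ (two * oddQuotient j)
        ≈⟨ ×-congʳ (suc j) (evenPart-twice (λ i → inv i * h (suc i)) j) ⟩
      suc j ·ᴿ ((1# + (- 1#) ^ᴿ j) * (inv j * h (suc j)))
        ≈⟨ ×≈ι* (suc j) _ ⟩
      ι (suc j) * ((1# + (- 1#) ^ᴿ j) * (inv j * h (suc j)))
        ≈⟨ solve 4 (λ i s v x → i :* ((con (+ 1) :+ s) :* (v :* x)) := (i :* v) :* (x :- (:- con (+ 1) :* s) :* x))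
                 refl (ι (suc j)) ((- 1#) ^ᴿ j) (inv j) (h (suc j)) ⟩
      (ι (suc j) * inv j) * (h (suc j) - scale (- 1#) h (suc j))
        ≈⟨ trans (*-congʳ (inv-ι j)) (*-identityˡ _) ⟩
      h (suc j) - scale (- 1#) h (suc j)
        ∎

    h[-x]⊛pow₂≋h : scale (- 1#) h ⊛ pow two ≋ h
    h[-x]⊛pow₂≋h = Solves-unique product h-solves initial
      where
      product : Solves 1# 1# m (scale (- 1#) h ⊛ pow two)
      product = Solves-cong (solve 0 (:- con (+ 1) :* con (+ 1) :+ (con (+ 1) :+ con (+ 1)) := con (+ 1)) refl)
                            (trans (+-identityʳ _) (trans (*-identityʳ _) -1ᵈ≈1))
                            (Solves-⊛ (Solves-scale (- 1#) h-solves) (Solves-pow two m))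
      initial : (scale (- 1#) h ⊛ pow two) 0 ≈ h 0
      initial = trans (⊛-zero-index (scale (- 1#) h) (pow two)) (trans (*-identityʳ _) (*-identityˡ _))

    h[-x]⊛E≋h-h[-x] : scale (- 1#) h ⊛ E ≋ λ n → h n - scale (- 1#) h n
    h[-x]⊛E≋h-h[-x] n = begin
      (T ⊛ E) n                                        ≈⟨ ⊛-congʳ T E≋pow₂-δ₀ n ⟩
      (T ⊛ (λ k → pow two k + - 1# * δ₀ k)) n          ≈⟨ ⊛-distribˡ-+ T (pow two) (λ k → - 1# * δ₀ k) n ⟩
      (T ⊛ pow two) n + (T ⊛ (λ k → - 1# * δ₀ k)) n    ≈⟨ +-cong (h[-x]⊛pow₂≋h n) (⊛-*ʳ (- 1#) T δ₀ n) ⟩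
      h n + - 1# * (T ⊛ δ₀) n                          ≈⟨ +-congˡ (*-congˡ (⊛-identityʳ T n)) ⟩
      h n + - 1# * T n                                 ≈⟨ +-congˡ (solve 1 (λ x → :- con (+ 1) :* x := :- x) refl (T n)) ⟩
      h n - T n                                        ∎
      where
      T = scale (- 1#) h

    oddQuotient⊛B₂≋h[-x] : oddQuotient ⊛ B₂ ≋ scale (- 1#) h
    oddQuotient⊛B₂≋h[-x] n = begin
      S n                  ≈⟨ solve 2 (λ s t → s := (s :- t) :+ t) refl (S n) (T n) ⟩
      (S n - T n) + T n    ≈⟨ +-congʳ (⊛-cancelʳ inv inv-ι E (inv 1) refl E1·inv1≈1 (λ k → S k - T k) difference⊛E≈0 n) ⟩
      0# + T n             ≈⟨ +-identityˡ _ ⟩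
      T n                  ∎
      where
      S = oddQuotient ⊛ B₂
      T = scale (- 1#) h
      E1·inv1≈1 : E 1 * inv 1 ≈ 1#
      E1·inv1≈1 = trans (*-congʳ (solve 0 ((con (+ 1) :+ con (+ 1)) :* con (+ 1) := con (+ 1) :+ (con (+ 1) :+ con (+ 0))) refl))
                        (inv-ι 1)
      difference⊛E≈0 : (λ k → S k - T k) ⊛ E ≋ λ _ → 0#
      difference⊛E≈0 n = begin
        ((λ k → S k - T k) ⊛ E) n
          ≈⟨ ⊛-distribʳ-+ S (λ k → - T k) E n ⟩
        (S ⊛ E) n + ((λ k → - T k) ⊛ E) n
          ≈⟨ +-congˡ (trans (⊛-congˡ E (λ k → solve 1 (λ x → :- x := :- con (+ 1) :* x) refl (T k)) n) (⊛-*ˡ (- 1#) T E n)) ⟩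
        (S ⊛ E) n + - 1# * (T ⊛ E) n
          ≈⟨ +-cong (trans ([oddQuotient⊛B₂]⊛E≋2x·oddQuotient n) (2x·oddQuotient≋h-h[-x] n)) (*-congˡ (h[-x]⊛E≋h-h[-x] n)) ⟩
        (h n - T n) + - 1# * (h n - T n)
          ≈⟨ solve 1 (λ x → x :+ :- con (+ 1) :* x := con (+ 0)) refl (h n - T n) ⟩
        0#
          ∎

ℤ-ring : CommutativeRing 0ℓ 0ℓ
ℤ-ring = ℤP.+-*-commutativeRing

module ℤRing = RingOps ℤ-ring

·ᴿ≡+*ℤ : ∀ k x → k ℤRing.·ᴿ x ≡ + k ℤ.* x
·ᴿ≡+*ℤ zero    x = ≡.refl
·ᴿ≡+*ℤ (suc k) x = begin
  x ℤ.+ k ℤRing.·ᴿ x           ≡⟨ ≡.cong (λ y → x ℤ.+ y) (·ᴿ≡+*ℤ k x) ⟩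
  x ℤ.+ + k ℤ.* x              ≡⟨ ≡.cong (ℤ._+ (+ k ℤ.* x)) (ℤP.*-identityˡ x) ⟨
  + 1 ℤ.* x ℤ.+ + k ℤ.* x      ≡⟨ ℤP.*-distribʳ-+ x (+ 1) (+ k) ⟨
  + suc k ℤ.* x                ∎
  where open ≡.≡-Reasoning

ιℤ : ∀ n → ℤRing.ι n ≡ + n
ιℤ n = ≡.trans (·ᴿ≡+*ℤ n (+ 1)) (ℤP.*-identityʳ (+ n))

^ᴿ≡^ℤ : ∀ x n → x ℤRing.^ᴿ n ≡ x ℤ.^ n
^ᴿ≡^ℤ x zero    = ≡.refl
^ᴿ≡^ℤ x (suc n) = ≡.cong (x ℤ.*_) (^ᴿ≡^ℤ x n)

-- Solutions of u′ = κ x^m u with u(0) = 1 are exp(κ x^(m+1) / (m+1)): they vanish off the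
-- multiples of m + 1, and u((m+1)q) = ((m+1)q)! / (q! e^q) when κ e = m + 1.
module FactorialRecurrence (m κ e : ℕ) (κe≡1+m : κ ℕ.* e ≡ suc m) (u : ℕ → ℤ) (u-zero : u 0 ≡ + 1)
                           (u-solves : ExponentialSeries.Solves ℤ-ring (+ 0) (+ κ) m u) where
  open ExponentialSeries ℤ-ring using (recurrence; mulXⁿ≈ff·)

  u-suc : ∀ n → u (suc n) ≡ + κ ℤ.* (+ ff n m ℤ.* u (n ∸ m))
  u-suc n = begin
    u (suc n)                           ≡⟨ recurrence u-solves n ⟩
    + 0 ℤ.* u n ℤ.+ + κ ℤ.* M           ≡⟨ ≡.cong (ℤ._+ (+ κ ℤ.* M)) (ℤP.*-zeroˡ (u n)) ⟩
    + 0 ℤ.+ + κ ℤ.* M                   ≡⟨ ℤP.+-identityˡ _ ⟩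
    + κ ℤ.* M                           ≡⟨ ≡.cong (+ κ ℤ.*_) (mulXⁿ≈ff· m u n) ⟩
    + κ ℤ.* (ff n m ℤRing.·ᴿ u (n ∸ m)) ≡⟨ ≡.cong (+ κ ℤ.*_) (·ᴿ≡+*ℤ (ff n m) (u (n ∸ m))) ⟩
    + κ ℤ.* (+ ff n m ℤ.* u (n ∸ m))    ∎
    where
    open ≡.≡-Reasoning
    M = ExponentialSeries.mulXⁿ ℤ-ring m u n

  vanishes : ∀ n → ¬ (suc m ∣ n) → u n ≡ + 0
  vanishes n = below (suc n) n (ℕP.n<1+n n)
    where
    below : ∀ N n → n < N → ¬ (suc m ∣ n) → u n ≡ + 0
    below (suc N) zero    _         1+m∤0   = ⊥-elim (1+m∤0 (divides 0 ≡.refl))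
    below (suc N) (suc n) (s≤s n<N) 1+m∤1+n = ≡.trans (u-suc n) (≡.trans (≡.cong (+ κ ℤ.*_) term≡0) (ℤP.*-zeroʳ (+ κ)))
      where
      1+m∤n∸m : m ≤ n → ¬ (suc m ∣ n ∸ m)
      1+m∤n∸m m≤n 1+m∣n∸m = 1+m∤1+n (≡.subst (suc m ∣_) n∸m+[1+m]≡1+n (∣m∣n⇒∣m+n 1+m∣n∸m ∣-refl))
        where
        n∸m+[1+m]≡1+n : n ∸ m ℕ.+ suc m ≡ suc n
        n∸m+[1+m]≡1+n = ≡.trans (ℕP.+-suc (n ∸ m) m) (≡.cong suc (ℕP.m∸n+n≡m m≤n))
      term≡0 : + ff n m ℤ.* u (n ∸ m) ≡ + 0
      term≡0 with m ℕP.≤? n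
      ... | no m≰n  = ≡.trans (≡.cong (λ f → + f ℤ.* u (n ∸ m)) (ff-< (ℕP.≰⇒> m≰n))) (ℤP.*-zeroˡ (u (n ∸ m)))
      ... | yes m≤n = ≡.trans (≡.cong (+ ff n m ℤ.*_) (below N (n ∸ m) (ℕP.≤-<-trans (ℕP.m∸n≤m n m) n<N) (1+m∤n∸m m≤n)))
                              (ℤP.*-zeroʳ (+ ff n m))

  at-multiple : ∀ q → u (q ℕ.* suc m) ℤ.* + (q ! ℕ.* e ^ q) ≡ + ((q ℕ.* suc m) !)
  at-multiple zero    = ≡.cong (ℤ._* + 1) u-zero
  at-multiple (suc q) = begin
    u (suc (m ℕ.+ a)) ℤ.* + (suc q ! ℕ.* e ^ suc q)
      ≡⟨ ≡.cong₂ ℤ._*_ u[1+m+a] (≡.trans (≡.cong +_ reorder) (ℤP.pos-* (suc q ℕ.* e) (q ! ℕ.* e ^ q))) ⟩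
    (+ κ ℤ.* (+ F ℤ.* u a)) ℤ.* (+ (suc q ℕ.* e) ℤ.* + (q ! ℕ.* e ^ q))
      ≡⟨ regroup (+ κ) (+ F) (u a) (+ (suc q ℕ.* e)) (+ (q ! ℕ.* e ^ q)) ⟩
    (+ κ ℤ.* + F ℤ.* + (suc q ℕ.* e)) ℤ.* (u a ℤ.* + (q ! ℕ.* e ^ q))
      ≡⟨ ≡.cong ((+ κ ℤ.* + F ℤ.* + (suc q ℕ.* e)) ℤ.*_) (at-multiple q) ⟩
    (+ κ ℤ.* + F ℤ.* + (suc q ℕ.* e)) ℤ.* + (a !)
      ≡⟨ pos-*-*-* κ F (suc q ℕ.* e) (a !) ⟨
    + (κ ℕ.* F ℕ.* (suc q ℕ.* e) ℕ.* a !)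
      ≡⟨ ≡.cong +_ factorial ⟩
    + ((suc q ℕ.* suc m) !) ∎
    where
    open ≡.≡-Reasoning
    a = q ℕ.* suc m
    F = ff (m ℕ.+ a) m
    u[1+m+a] : u (suc (m ℕ.+ a)) ≡ + κ ℤ.* (+ F ℤ.* u a)
    u[1+m+a] = ≡.trans (u-suc (m ℕ.+ a)) (≡.cong (λ i → + κ ℤ.* (+ F ℤ.* u i)) (ℕP.m+n∸m≡n m a))
    reorder : suc q ! ℕ.* e ^ suc q ≡ suc q ℕ.* e ℕ.* (q ! ℕ.* e ^ q)
    reorder = solve 4 (λ s f x p → (s :* f) :* (x :* p) := s :* x :* (f :* p)) ≡.refl (suc q) (q !) e (e ^ q)
      where open ℕSolver.+-*-Solver
    pos-*-*-* : ∀ w x y z → + (w ℕ.* x ℕ.* y ℕ.* z) ≡ + w ℤ.* + x ℤ.* + y ℤ.* + z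
    pos-*-*-* w x y z = ≡.trans (ℤP.pos-* (w ℕ.* x ℕ.* y) z)
                          (≡.cong (ℤ._* + z) (≡.trans (ℤP.pos-* (w ℕ.* x) y) (≡.cong (ℤ._* + y) (ℤP.pos-* w x))))
    regroup : ∀ k f x s y → (k ℤ.* (f ℤ.* x)) ℤ.* (s ℤ.* y) ≡ (k ℤ.* f ℤ.* s) ℤ.* (x ℤ.* y)
    regroup = solve 5 (λ k f x s y → (k :* (f :* x)) :* (s :* y) := (k :* f :* s) :* (x :* y)) ≡.refl
      where open ℤSolver.+-*-Solver
    factorial : κ ℕ.* F ℕ.* (suc q ℕ.* e) ℕ.* a ! ≡ (suc q ℕ.* suc m) !
    factorial = begin
      κ ℕ.* F ℕ.* (suc q ℕ.* e) ℕ.* a !      ≡⟨ regroupℕ κ F (suc q) e (a !) ⟩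
      suc q ℕ.* (κ ℕ.* e) ℕ.* (F ℕ.* a !)    ≡⟨ ≡.cong₂ (λ x y → suc q ℕ.* x ℕ.* y) κe≡1+m (ff-*-! m a) ⟩
      suc q ℕ.* suc m ℕ.* (m ℕ.+ a) !        ∎
      where
      regroupℕ : ∀ k f s x y → k ℕ.* f ℕ.* (s ℕ.* x) ℕ.* y ≡ s ℕ.* (k ℕ.* x) ℕ.* (f ℕ.* y)
      regroupℕ = solve 5 (λ k f s x y → k :* f :* (s :* x) :* y := s :* (k :* x) :* (f :* y)) ≡.refl
        where open ℕSolver.+-*-Solver

ℚ-ring : CommutativeRing 0ℓ 0ℓ
ℚ-ring = ℚP.+-*-commutativeRing

module ℚRing = RingOps ℚ-ring

toℚᵘ-/ : ∀ i b → ℚ.toℚᵘ (i ℚ./ suc b) ℚᵘ.≃ mkℚᵘ i b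
toℚᵘ-/ i b = ℚP.toℚᵘ-fromℚᵘ (mkℚᵘ i b)

/-cross : ∀ i j b c → i ℤ.* + suc c ≡ j ℤ.* + suc b → i ℚ./ suc b ≡ j ℚ./ suc c
/-cross i j b c eq = ℚP.toℚᵘ-injective (ℚᵘP.≃-trans (toℚᵘ-/ i b) (ℚᵘP.≃-trans (*≡* eq) (ℚᵘP.≃-sym (toℚᵘ-/ j c))))

ιℚ : ∀ n → ℚRing.ι n ≡ ℤ→ℚ (+ n)
ιℚ zero    = ≡.refl
ιℚ (suc n) = ≡.trans (≡.cong (ℚ.1ℚ ℚ.+_) (ιℚ n)) (ℚP.toℚᵘ-injective (begin
  ℚ.toℚᵘ (ℚ.1ℚ ℚ.+ ℤ→ℚ (+ n))                 ≈⟨ ℚP.toℚᵘ-homo-+ ℚ.1ℚ (ℤ→ℚ (+ n)) ⟩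
  ℚ.toℚᵘ ℚ.1ℚ ℚᵘ.+ ℚ.toℚᵘ (ℤ→ℚ (+ n))        ≈⟨ ℚᵘP.+-cong (toℚᵘ-/ (+ 1) 0) (toℚᵘ-/ (+ n) 0) ⟩
  mkℚᵘ (+ 1) 0 ℚᵘ.+ mkℚᵘ (+ n) 0             ≈⟨ *≡* (solve 1 (λ x → (con (+ 1) :* con (+ 1) :+ x :* con (+ 1)) :* con (+ 1)
                                                                 := (con (+ 1) :+ x) :* (con (+ 1) :* con (+ 1))) ≡.refl (+ n)) ⟩
  mkℚᵘ (+ suc n) 0                           ≈⟨ toℚᵘ-/ (+ suc n) 0 ⟨
  ℚ.toℚᵘ (ℤ→ℚ (+ suc n))                     ∎))
  where
  open import Relation.Binary.Reasoning.Setoid ℚᵘP.≃-setoid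
  open ℤSolver.+-*-Solver

ℤ→ℚ≡fromℤ : ∀ z → ℤ→ℚ z ≡ IntegerEmbedding.fromℤ ℚ-ring z
ℤ→ℚ≡fromℤ (+ n)      = ≡.sym (ιℚ n)
ℤ→ℚ≡fromℤ -[1+ n ]   = ≡.cong ℚ.-_ (≡.sym (ιℚ (suc n)))

ℤ→ℚ-* : ∀ z w → ℤ→ℚ (z ℤ.* w) ≡ ℤ→ℚ z ℚ.* ℤ→ℚ w
ℤ→ℚ-* z w = ≡.trans (ℤ→ℚ≡fromℤ (z ℤ.* w))
           (≡.trans (IntegerEmbedding.fromℤ-* ℚ-ring z w) (≡.sym (≡.cong₂ ℚ._*_ (ℤ→ℚ≡fromℤ z) (ℤ→ℚ≡fromℤ w))))

ℤ→ℚ-^ : ∀ z n → ℤ→ℚ (z ℤ.^ n) ≡ ℤ→ℚ z ℚRing.^ᴿ n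
ℤ→ℚ-^ z zero    = ≡.refl
ℤ→ℚ-^ z (suc n) = ≡.trans (ℤ→ℚ-* z (z ℤ.^ n)) (≡.cong (ℤ→ℚ z ℚ.*_) (ℤ→ℚ-^ z n))

nonZero-!*^ : ∀ q e .{{_ : ℕ.NonZero e}} → ℕ.NonZero (q ! ℕ.* e ^ q)
nonZero-!*^ q e = ℕP.m*n≢0 (q !) (e ^ q) {{q ℕP.!≢0}} {{ℕP.m^n≢0 e q}}

ℤ→ℚ≡frac : ∀ z a b .{{_ : ℕ.NonZero b}} → z ℤ.* + b ≡ + a → ℤ→ℚ z ≡ frac a b
ℤ→ℚ≡frac z a (suc b) eq = /-cross z (+ a) 0 b (≡.trans eq (≡.sym (ℤP.*-identityʳ (+ a))))

frac≡ι*frac1 : ∀ a b → frac a (suc b) ≡ ℚRing.ι a ℚ.* frac 1 (suc b)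
frac≡ι*frac1 a b = ≡.sym (≡.trans (≡.cong (ℚ._* frac 1 (suc b)) (ιℚ a)) (ℚP.toℚᵘ-injective (begin
  ℚ.toℚᵘ (ℤ→ℚ (+ a) ℚ.* frac 1 (suc b))               ≈⟨ ℚP.toℚᵘ-homo-* (ℤ→ℚ (+ a)) (frac 1 (suc b)) ⟩
  ℚ.toℚᵘ (ℤ→ℚ (+ a)) ℚᵘ.* ℚ.toℚᵘ (frac 1 (suc b))     ≈⟨ ℚᵘP.*-cong (toℚᵘ-/ (+ a) 0) (toℚᵘ-/ (+ 1) b) ⟩
  mkℚᵘ (+ a) 0 ℚᵘ.* mkℚᵘ (+ 1) b                      ≈⟨ *≡* (≡.trans (≡.cong (ℤ._* + suc b) (ℤP.*-identityʳ (+ a)))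
                                                                (≡.cong (λ c → + a ℤ.* + suc c) (≡.sym (ℕP.+-identityʳ b)))) ⟩
  mkℚᵘ (+ a) b                                        ≈⟨ toℚᵘ-/ (+ a) b ⟨
  ℚ.toℚᵘ (frac a (suc b))                             ∎)))
  where open import Relation.Binary.Reasoning.Setoid ℚᵘP.≃-setoid

ι*frac1≡1 : ∀ j → ℚRing.ι (suc j) ℚ.* frac 1 (suc j) ≡ ℚ.1ℚ
ι*frac1≡1 j = ≡.trans (≡.sym (frac≡ι*frac1 (suc j) j)) (/-cross (+ suc j) (+ 1) j 0 (ℤP.*-comm (+ suc j) (+ 1)))

module IntegerIdentities (m : ℕ) where
  open ExponentialSeries ℤ-ring
  open HSeries ℤ-ring m

  d : ℕ
  d = suc m

  -1ℤ : ℤ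
  -1ℤ = ℤ.- ℤ.1ℤ

  binomialInverse≡h⊛pow[-1] : ∀ n →
    sumℤ n (λ k → + (n C k) ℤ.* (-1ℤ ℤ.^ (n ∸ k)) ℤ.* + (H d k)) ≡ (h ⊛ pow -1ℤ) n
  binomialInverse≡h⊛pow[-1] n = Σ-cong (suc n) λ k → ≡.sym (begin
    (n C k) ℤRing.·ᴿ (h k ℤ.* pow -1ℤ (n ∸ k))
      ≡⟨ ·ᴿ≡+*ℤ (n C k) _ ⟩
    + (n C k) ℤ.* (h k ℤ.* pow -1ℤ (n ∸ k))
      ≡⟨ ≡.cong₂ (λ x y → + (n C k) ℤ.* (x ℤ.* y)) (ιℤ (H d k)) (^ᴿ≡^ℤ -1ℤ (n ∸ k)) ⟩
    + (n C k) ℤ.* (+ H d k ℤ.* -1ℤ ℤ.^ (n ∸ k))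
      ≡⟨ solve 3 (λ c x s → c :* (x :* s) := c :* s :* x) ≡.refl (+ (n C k)) (+ H d k) (-1ℤ ℤ.^ (n ∸ k)) ⟩
    + (n C k) ℤ.* (-1ℤ ℤ.^ (n ∸ k)) ℤ.* + (H d k)
      ∎)
    where open ≡.≡-Reasoning

  signedSquare≡h[-x]⊛h : ∀ n →
    sumℤ n (λ k → + (n C k) ℤ.* (-1ℤ ℤ.^ k) ℤ.* + (H d k) ℤ.* + (H d (n ∸ k))) ≡ (scale -1ℤ h ⊛ h) n
  signedSquare≡h[-x]⊛h n = Σ-cong (suc n) λ k → ≡.sym (begin
    (n C k) ℤRing.·ᴿ (-1ℤ ℤRing.^ᴿ k ℤ.* h k ℤ.* h (n ∸ k))
      ≡⟨ ·ᴿ≡+*ℤ (n C k) _ ⟩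
    + (n C k) ℤ.* (-1ℤ ℤRing.^ᴿ k ℤ.* h k ℤ.* h (n ∸ k))
      ≡⟨ ≡.cong₂ (λ x y → + (n C k) ℤ.* (x ℤ.* y)) (≡.cong₂ ℤ._*_ (^ᴿ≡^ℤ -1ℤ k) (ιℤ (H d k))) (ιℤ (H d (n ∸ k))) ⟩
    + (n C k) ℤ.* (-1ℤ ℤ.^ k ℤ.* + H d k ℤ.* + H d (n ∸ k))
      ≡⟨ solve 4 (λ c s x y → c :* (s :* x :* y) := c :* s :* x :* y) ≡.refl (+ (n C k)) (-1ℤ ℤ.^ k) (+ H d k) (+ H d (n ∸ k)) ⟩
    + (n C k) ℤ.* (-1ℤ ℤ.^ k) ℤ.* + (H d k) ℤ.* + (H d (n ∸ k))
      ∎)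
    where open ≡.≡-Reasoning

  private
    module BinomialInverse = FactorialRecurrence m 1 d (ℕP.*-identityˡ d) (h ⊛ pow -1ℤ) h⊛pow[-1]-zero h⊛pow[-1]-solves

  binomialInverse-vanishes : ∀ n → ¬ (d ∣ n) →
    sumℤ n (λ k → + (n C k) ℤ.* (-1ℤ ℤ.^ (n ∸ k)) ℤ.* + (H d k)) ≡ + 0
  binomialInverse-vanishes n d∤n = ≡.trans (binomialInverse≡h⊛pow[-1] n) (BinomialInverse.vanishes n d∤n)

  binomialInverse-multiple : ∀ q → let n = q ℕ.* d in
    ℤ→ℚ (sumℤ n (λ k → + (n C k) ℤ.* (-1ℤ ℤ.^ (n ∸ k)) ℤ.* + (H d k))) ≡ frac (n !) (q ! ℕ.* d ^ q)
  binomialInverse-multiple q = ≡.trans (≡.cong ℤ→ℚ (binomialInverse≡h⊛pow[-1] (q ℕ.* d)))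
    (ℤ→ℚ≡frac ((h ⊛ pow -1ℤ) (q ℕ.* d)) ((q ℕ.* d) !) (q ! ℕ.* d ^ q) {{nonZero-!*^ q d}} (BinomialInverse.at-multiple q))

  signedSquare-odd : ¬ (2 ∣ d) → ∀ n →
    sumℤ (suc n) (λ k → + (suc n C k) ℤ.* (-1ℤ ℤ.^ k) ℤ.* + (H d k) ℤ.* + (H d (suc n ∸ k))) ≡ + 0
  signedSquare-odd 2∤d n = ≡.trans (signedSquare≡h[-x]⊛h (suc n)) (h[-x]⊛h-vanishes (-1^odd≈-1 2∤d) n)

  module SignedSquare (2∣d : 2 ∣ d) where
    private
      e : ℕ
      e = d ℕ./ 2

      2e≡d : 2 ℕ.* e ≡ d
      2e≡d = ℕDM.m*[n/m]≡n 2∣d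

      instance
        e≢0 : ℕ.NonZero e
        e≢0 = ℕ.≢-nonZero (λ e≡0 → ℕP.0≢1+n (≡.trans (≡.cong (2 ℕ.*_) (≡.sym e≡0)) 2e≡d))

      -1ᵈ+1≡2 : -1ℤ ℤRing.^ᴿ d ℤ.+ + 1 ≡ + 2
      -1ᵈ+1≡2 = ≡.cong (ℤ._+ + 1) (-1^even≈1 2∣d)

      module Recurrence = FactorialRecurrence m 2 e 2e≡d (scale -1ℤ h ⊛ h) (h[ζx]⊛h-zero -1ℤ)
                                              (Solves-cong ≡.refl -1ᵈ+1≡2 h[-x]⊛h-solves)

    signedSquare-vanishes : ∀ n → ¬ (d ∣ n) →
      sumℤ n (λ k → + (n C k) ℤ.* (-1ℤ ℤ.^ k) ℤ.* + (H d k) ℤ.* + (H d (n ∸ k))) ≡ + 0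
    signedSquare-vanishes n d∤n = ≡.trans (signedSquare≡h[-x]⊛h n) (Recurrence.vanishes n d∤n)

    signedSquare-multiple : ∀ q → let n = q ℕ.* d in
      ℤ→ℚ (sumℤ n (λ k → + (n C k) ℤ.* (-1ℤ ℤ.^ k) ℤ.* + (H d k) ℤ.* + (H d (n ∸ k)))) ≡ frac (n !) (q ! ℕ.* e ^ q)
    signedSquare-multiple q = ≡.trans (≡.cong ℤ→ℚ (signedSquare≡h[-x]⊛h (q ℕ.* d)))
      (ℤ→ℚ≡frac ((scale -1ℤ h ⊛ h) (q ℕ.* d)) ((q ℕ.* d) !) (q ! ℕ.* e ^ q) {{nonZero-!*^ q e}} (Recurrence.at-multiple q))

module BernoulliSum (m : ℕ) (B : ℕ → ℚ) (isB : IsBernoulli B) (2∣d : 2 ∣ suc m) where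
  open ExponentialSeries ℚ-ring
  open HSeries ℚ-ring m
  open import Algebra.Properties.Semiring.Mult ℚRing.semiring using (×-congʳ)

  d : ℕ
  d = suc m

  inv : ℕ → ℚ
  inv j = frac 1 (suc j)

  B-rec : ∀ n → Σ n (λ k → ℚRing.ι (n C k) ℚ.* B k) ≡ mulX δ₀ n
  B-rec n = ≡.trans (Σ-cong n (λ k → ≡.cong (ℚ._* B k) (ιℚ (n C k)))) (≡.trans (isB n) (δ₁≡x n))
    where
    δ₁≡x : ∀ n → δ₁ n ≡ mulX δ₀ n
    δ₁≡x zero                = ≡.refl
    δ₁≡x (suc zero)          = ≡.sym (ℚP.+-identityʳ ℚ.1ℚ)
    δ₁≡x (suc (suc n))       = ≡.sym (×-zeroʳ (suc (suc n)))

  open Bernoulli inv ι*frac1≡1 B B-rec (-1^even≈1 2∣d)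

  summand : ℕ → ℕ → ℚ
  summand n k = ℤ→ℚ (+ (n C (2 ℕ.* k))) ℚ.* frac (2 ℕ.^ (n ∸ 2 ℕ.* k)) (2 ℕ.* k ℕ.+ 1)
                  ℚ.* B (n ∸ 2 ℕ.* k) ℚ.* ℤ→ℚ (+ (H d (2 ℕ.* k ℕ.+ 1)))

  convolutionTerm : ℕ → ℕ → ℚ
  convolutionTerm n j = (n C j) ℚRing.·ᴿ (oddQuotient j ℚ.* B₂ (n ∸ j))

  ι-2^ : ∀ i → ℚRing.ι (2 ℕ.^ i) ≡ two ℚRing.^ᴿ i
  ι-2^ zero    = ℚP.+-identityʳ ℚ.1ℚ
  ι-2^ (suc i) = ≡.trans (ι-* 2 (2 ℕ.^ i)) (≡.cong₂ ℚ._*_ (≡.cong (ℚ.1ℚ ℚ.+_) (ℚP.+-identityʳ ℚ.1ℚ)) (ι-2^ i))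

  summand≡ : ∀ n k → summand n k ≡ convolutionTerm n (2 ℕ.* k)
  summand≡ n k = begin
    summand n k
      ≡⟨ ≡.cong (λ i → ℤ→ℚ (+ c) ℚ.* frac (2 ℕ.^ (n ∸ j)) i ℚ.* B (n ∸ j) ℚ.* ℤ→ℚ (+ (H d i))) (ℕP.+-comm j 1) ⟩
    ℤ→ℚ (+ c) ℚ.* frac (2 ℕ.^ (n ∸ j)) (suc j) ℚ.* B (n ∸ j) ℚ.* ℤ→ℚ (+ (H d (suc j)))
      ≡⟨ ≡.cong₂ (λ x y → x ℚ.* B (n ∸ j) ℚ.* y)
                 (≡.cong₂ ℚ._*_ (≡.sym (ιℚ c)) (≡.trans (frac≡ι*frac1 (2 ℕ.^ (n ∸ j)) j) (≡.cong (ℚ._* inv j) (ι-2^ (n ∸ j)))))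
                 (≡.sym (ιℚ (H d (suc j)))) ⟩
    ℚRing.ι c ℚ.* (two ℚRing.^ᴿ (n ∸ j) ℚ.* inv j) ℚ.* B (n ∸ j) ℚ.* h (suc j)
      ≡⟨ solve 5 (λ c t i b x → c :* (t :* i) :* b :* x := c :* ((i :* x) :* (t :* b))) ≡.refl
               (ℚRing.ι c) (two ℚRing.^ᴿ (n ∸ j)) (inv j) (B (n ∸ j)) (h (suc j)) ⟩
    ℚRing.ι c ℚ.* ((inv j ℚ.* h (suc j)) ℚ.* B₂ (n ∸ j))
      ≡⟨ ≡.sym (×≈ι* c _) ⟩
    c ℚRing.·ᴿ ((inv j ℚ.* h (suc j)) ℚ.* B₂ (n ∸ j))
      ≡⟨ ≡.cong (λ x → c ℚRing.·ᴿ (x ℚ.* B₂ (n ∸ j))) (evenPart-even (λ i → inv i ℚ.* h (suc i)) k) ⟨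
    convolutionTerm n j ∎
    where
    open ≡.≡-Reasoning
    j = 2 ℕ.* k
    c = n C j

  convolutionTerm-odd : ∀ n k → convolutionTerm n (suc (2 ℕ.* k)) ≡ ℚ.0ℚ
  convolutionTerm-odd n k = ≡.trans (×-congʳ (n C j) (≡.trans (≡.cong (ℚ._* B₂ (n ∸ j)) (evenPart-odd (λ i → inv i ℚ.* h (suc i)) k))
                                                          (ℚP.*-zeroˡ (B₂ (n ∸ j)))))
                                    (×-zeroʳ (n C j))
    where
    j = suc (2 ℕ.* k)

  bernoulli-identity : ∀ n → sumℚ (n ℕ./ 2) (summand n) ≡ ℤ→ℚ (((ℤ.- ℤ.1ℤ) ℤ.^ n) ℤ.* + (H d n))
  bernoulli-identity n = begin
    sumℚ (n ℕ./ 2) (summand n)                          ≡⟨ Σ-cong (suc (n ℕ./ 2)) (summand≡ n) ⟩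
    Σ (suc (n ℕ./ 2)) (λ k → convolutionTerm n (2 ℕ.* k)) ≡⟨ Σ-evens n (convolutionTerm n) (convolutionTerm-odd n) ⟨
    (oddQuotient ⊛ B₂) n                                ≡⟨ oddQuotient⊛B₂≋h[-x] n ⟩
    (ℚ.- ℚ.1ℚ) ℚRing.^ᴿ n ℚ.* h n                       ≡⟨ ≡.cong₂ ℚ._*_ (≡.sym (ℤ→ℚ-^ (ℤ.- ℤ.1ℤ) n)) (ιℚ (H d n)) ⟩
    ℤ→ℚ ((ℤ.- ℤ.1ℤ) ℤ.^ n) ℚ.* ℤ→ℚ (+ (H d n))          ≡⟨ ℤ→ℚ-* ((ℤ.- ℤ.1ℤ) ℤ.^ n) (+ (H d n)) ⟨
    ℤ→ℚ (((ℤ.- ℤ.1ℤ) ℤ.^ n) ℤ.* + (H d n))              ∎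
    where open ≡.≡-Reasoning

mainTheorem17 : (d : ℕ) → 2 ℕ.≤ d →
    -- (1)
    ( (∀ (n : ℕ) → ¬ (d ∣ n) →
         sumℤ n (λ k → + (n C k) ℤ.* ((ℤ.- ℤ.1ℤ) ℤ.^ (n ℕ.∸ k)) ℤ.* + (H d k)) ≡ + 0)
    × (∀ (n m : ℕ) → n ≡ m ℕ.* d →
         ℤ→ℚ (sumℤ n (λ k → + (n C k) ℤ.* ((ℤ.- ℤ.1ℤ) ℤ.^ (n ℕ.∸ k)) ℤ.* + (H d k)))
           ≡ frac ((m ℕ.* d) ℕ.!) ((m ℕ.!) ℕ.* (d ℕ.^ m))) )
    -- (2)
    × ( ¬ (2 ∣ d) → ∀ (n : ℕ) → 1 ℕ.≤ n →
         sumℤ n (λ k → + (n C k) ℤ.* ((ℤ.- ℤ.1ℤ) ℤ.^ k) ℤ.* + (H d k) ℤ.* + (H d (n ℕ.∸ k))) ≡ + 0 )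
    -- (3)
    × ( 2 ∣ d →
        (∀ (n : ℕ) → 1 ℕ.≤ n → ¬ (d ∣ n) →
           sumℤ n (λ k → + (n C k) ℤ.* ((ℤ.- ℤ.1ℤ) ℤ.^ k) ℤ.* + (H d k) ℤ.* + (H d (n ℕ.∸ k))) ≡ + 0)
      × (∀ (n m : ℕ) → 1 ℕ.≤ n → n ≡ m ℕ.* d →
           ℤ→ℚ (sumℤ n (λ k → + (n C k) ℤ.* ((ℤ.- ℤ.1ℤ) ℤ.^ k) ℤ.* + (H d k) ℤ.* + (H d (n ℕ.∸ k))))
             ≡ frac ((m ℕ.* d) ℕ.!) ((m ℕ.!) ℕ.* ((d ℕ./ 2) ℕ.^ m))) )
    -- (4)
    × ( (R : CommutativeRing 0ℓ 0ℓ) → let open RingOps R in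
        (ζ ζ⁻¹ : Carrier) → ζ ^ᴿ d ≈ 1# → ζ * ζ⁻¹ ≈ 1# → ∀ (n : ℕ) →
          ι (H d n) ≈ (ζ⁻¹ ^ᴿ n) * sumᴿ n (λ k → (n C k) ·ᴿ (((ζ - 1#) ^ᴿ k) * ι (H d (n ℕ.∸ k)))) )
    -- (5)
    × ( (R : CommutativeRing 0ℓ 0ℓ) → let open RingOps R in
        (ζ : Carrier) → ζ ^ᴿ (2 ℕ.* d) ≈ 1# → ζ ^ᴿ d ≈ - 1# → ∀ (n : ℕ) →
          sumᴿ n (λ k → (n C k) ·ᴿ ((ζ ^ᴿ k) * ι (H d k) * ι (H d (n ℕ.∸ k)))) ≈ (1# + ζ) ^ᴿ n )
    -- (6)
    × ( (B : ℕ → ℚ) → IsBernoulli B → 2 ∣ d → ∀ (n : ℕ) →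
          sumℚ (n ℕ./ 2) (λ k →
              ℤ→ℚ (+ (n C (2 ℕ.* k))) ℚ.* frac (2 ℕ.^ (n ℕ.∸ 2 ℕ.* k)) (2 ℕ.* k ℕ.+ 1)
                ℚ.* B (n ℕ.∸ 2 ℕ.* k) ℚ.* ℤ→ℚ (+ (H d (2 ℕ.* k ℕ.+ 1))))
            ≡ ℤ→ℚ (((ℤ.- ℤ.1ℤ) ℤ.^ n) ℤ.* + (H d n)) )
    -- (7)  (summation index j = i - 1 for i = 1, ..., n)
    × ( ∀ (n : ℕ) →
          H d n ≡ 1 ℕ.+ sumLt ℕ._+_ 0 n (λ j → ff j (d ℕ.∸ 1) ℕ.* Hℤ d (+ (suc j) ℤ.- + d)) )
mainTheorem17 (suc zero) (s≤s ())
mainTheorem17 (suc (suc k)) _ =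
    (binomialInverse-vanishes , λ { _ q ≡.refl → binomialInverse-multiple q })
  , (λ { 2∤d (suc n) _ → signedSquare-odd 2∤d n })
  , (λ 2∣d → let open SignedSquare 2∣d in
       (λ n _ → signedSquare-vanishes n) , λ { _ q _ ≡.refl → signedSquare-multiple q })
  , (λ R ζ ζ⁻¹ ζᵈ≈1 ζζ⁻¹≈1 → HSeries.h≈ζ⁻ⁿ[pow[ζ-1]⊛h] R m ζ ζ⁻¹ ζᵈ≈1 ζζ⁻¹≈1)
  , (λ R ζ _ ζᵈ≈-1 → HSeries.h[ζx]⊛h≋pow[1+ζ] R m ζ ζᵈ≈-1)
  , (λ B isB 2∣d → BernoulliSum.bernoulli-identity m B isB 2∣d)
  , H-unfold m
  where
  m = suc k
  open IntegerIdentities m
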